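{- Let $A$ be a finite alphabet. Considered both as families of languages (defined by sentences) and as families of sets of marked words (defined by formulas with one free variable), the logics $FO^2[<,\mathrm{betfac}]$ and $FO^2[<,\mathrm{thfac}]$ over $A$ have the same expressive power.
   Context: Words over a finite alphabet $A$ have positions $1,\dots,|w|$; $w(i)$ is the $i$-th letter; a marked word is $(w,i)$ with $w$ nonempty and $1\le i\le|w|$. First-order logic over words uses the order $<$ and unary predicates $a(x)$ ($a\in A$) meaning the letter at $x$ is $a$. For $u=a_1\cdots a_n\in A^+$, an occurrence of the factor $u$ strictly between $x$ and $y$ means positions $z,z+1,\dots,z+n-1$ with $x<z$, $z+n-1<y$ and $w(z+t-1)=a_t$ for $t=1,\dots,n$. $FO^2[<,\mathrm{betfac}]$ is the two-variable first-order logic (only two variable symbols, which may be reused) built from $<$, the unary letter predicates, and for each $u\in A^+$ the binary predicate $\langle u\rangle(x,y)$: there is an occurrence of $u$ strictly between $x$ and $y$. $FO^2[<,\mathrm{thfac}]$ is the two-variable logic built from $<$, the unary letter predicates and, for each $u\in A^+$ and integer $k\ge 0$, the binary predicate asserting that there are at least $k$ (possibly overlapping) occurrences of $u$ strictly between $x$ and $y$. Sentences of these logics are interpreted only in nonempty words. -}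

module Defs where

open import Data.Nat using (ℕ; zero; suc; _+_; _<_; _≤_; _≥_; _<?_; _≤?_)
open import Data.Fin using (Fin; toℕ)
import Data.Fin as Fin
open import Data.List using (List; []; _∷_; length; take; drop; filter; upTo)
open import Data.List.NonEmpty using (List⁺; toList)
import Data.List.Properties as LP
open import Data.Product using (_×_; _,_; Σ)
open import Data.Empty using (⊥)
open import Data.Unit using (⊤)
open import Relation.Nullary using (¬_; Dec; yes; no)
open import Relation.Nullary.Decidable using (_×-dec_)
open import Relation.Binary.PropositionalEquality using (_≡_)
open import Function.Bundles using (_⇔_)

-- Words over the finite alphabet Fin k.  Positions of a word w are
-- Fin (length w), i.e. 0-indexed (position p here = position p+1 in the paper).

Word : ℕ → Set
Word k = List (Fin k)

OccursAt : ∀ {k} → List⁺ (Fin k) → Word k → ℕ → Set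
OccursAt u w z = take (length (toList u)) (drop z w) ≡ toList u

OccBetween : ∀ {k} → List⁺ (Fin k) → Word k → ℕ → ℕ → ℕ → Set
OccBetween u w x y z = (x < z) × ((z + length (toList u) ≤ y) × OccursAt u w z)

occBetween? : ∀ {k} (u : List⁺ (Fin k)) (w : Word k) (x y z : ℕ) → Dec (OccBetween u w x y z)
occBetween? u w x y z =
  (x <? z) ×-dec ((z + length (toList u) ≤? y)
    ×-dec LP.≡-dec Fin._≟_ (take (length (toList u)) (drop z w)) (toList u))

-- Number of (possibly overlapping) occurrences of u strictly between x and y.
occCount : ∀ {k} → List⁺ (Fin k) → Word k → ℕ → ℕ → ℕ
occCount u w x y = length (filter (occBetween? u w x y) (upTo (length w)))

data Var : Set where
  vx vy : Var

_≟v_ : (a b : Var) → Dec (a ≡ b)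
vx ≟v vx = yes _≡_.refl
vx ≟v vy = no (λ ())
vy ≟v vx = no (λ ())
vy ≟v vy = yes _≡_.refl

data FO2 (k : ℕ) (P : Set) : Set where
  letter : Fin k → Var → FO2 k P
  _≐_    : Var → Var → FO2 k P
  _≺_    : Var → Var → FO2 k P
  bin    : P → Var → Var → FO2 k P
  ¬'_    : FO2 k P → FO2 k P
  _∧'_   : FO2 k P → FO2 k P → FO2 k P
  ∃'     : Var → FO2 k P → FO2 k P

Free : ∀ {k P} → Var → FO2 k P → Set
Free v (letter a u) = v ≡ u
Free v (u ≐ u')     = (v ≡ u) Data.Sum.⊎ (v ≡ u')
  where import Data.Sum
Free v (u ≺ u')     = (v ≡ u) Data.Sum.⊎ (v ≡ u')
  where import Data.Sum
Free v (bin p u u') = (v ≡ u) Data.Sum.⊎ (v ≡ u')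
  where import Data.Sum
Free v (¬' φ)       = Free v φ
Free v (φ ∧' ψ)     = Free v φ Data.Sum.⊎ Free v ψ
  where import Data.Sum
Free v (∃' u φ) with v ≟v u
... | yes _ = ⊥
... | no  _ = Free v φ

Sentence : ∀ {k P} → FO2 k P → Set
Sentence φ = (v : Var) → ¬ Free v φ

OneFree : ∀ {k P} → FO2 k P → Set
OneFree φ = ¬ Free vy φ

Assign : ∀ {k} → Word k → Set
Assign w = Var → Fin (length w)

update : ∀ {k} {w : Word k} → Assign w → Var → Fin (length w) → Assign w
update ρ v i u with u ≟v v
... | yes _ = i
... | no  _ = ρ u

Sat : ∀ {k P} → (∀ (w : Word k) → P → ℕ → ℕ → Set) →
      (w : Word k) → Assign w → FO2 k P → Set
Sat I w ρ (letter a v) = Data.List.lookup w (ρ v) ≡ a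
  where import Data.List
Sat I w ρ (u ≐ u')     = ρ u ≡ ρ u'
Sat I w ρ (u ≺ u')     = toℕ (ρ u) < toℕ (ρ u')
Sat I w ρ (bin p u u') = I w p (toℕ (ρ u)) (toℕ (ρ u'))
Sat I w ρ (¬' φ)       = ¬ Sat I w ρ φ
Sat I w ρ (φ ∧' ψ)     = Sat I w ρ φ × Sat I w ρ ψ
Sat I w ρ (∃' v φ)     = Σ (Fin (length w)) λ i → Sat I w (update {w = w} ρ v i) φ

Betfac : ℕ → Set
Betfac k = List⁺ (Fin k)

betfacI : ∀ {k} → (w : Word k) → Betfac k → ℕ → ℕ → Set
betfacI w u x y = Σ ℕ λ z → OccBetween u w x y z

Thfac : ℕ → Set
Thfac k = List⁺ (Fin k) × ℕ

thfacI : ∀ {k} → (w : Word k) → Thfac k → ℕ → ℕ → Set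
thfacI w (u , n) x y = occCount u w x y ≥ n

FOBet FOTh : ℕ → Set
FOBet k = FO2 k (Betfac k)
FOTh  k = FO2 k (Thfac k)

SatBet : ∀ {k} (w : Word k) → Assign w → FOBet k → Set
SatBet = Sat betfacI

SatTh : ∀ {k} (w : Word k) → Assign w → FOTh k → Set
SatTh = Sat thfacI

-- Only nonempty words admit assignments
-- (Assign [] is empty), so quantifying over assignments restricts to
-- nonempty words.  For sentences the assignment is irrelevant (the
-- language defined); for one-free-variable formulas, ρ vx is the marked
-- position (the set of marked words defined).

EquivBT : ∀ {k} → FOBet k → FOTh k → Set
EquivBT {k} φ ψ = (w : Word k) (ρ : Assign w) → SatBet w ρ φ ⇔ SatTh w ρ ψ

SameLanguages : ℕ → Set
SameLanguages k =
  ((φ : FOBet k) → Sentence φ → Σ (FOTh k) λ ψ → Sentence ψ × EquivBT φ ψ) ×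
  ((ψ : FOTh k) → Sentence ψ → Σ (FOBet k) λ φ → Sentence φ × EquivBT φ ψ)

SameMarked : ℕ → Set
SameMarked k =
  ((φ : FOBet k) → OneFree φ → Σ (FOTh k) λ ψ → OneFree ψ × EquivBT φ ψ) ×
  ((ψ : FOTh k) → OneFree ψ → Σ (FOBet k) λ φ → OneFree φ × EquivBT φ ψ)

-- Each predicate ⟨u⟩ is the threshold predicate "at least one occurrence of u", which gives one
-- inclusion. For the other, formulas of FO²[<, thfac] are translated bottom-up. A quantification ∃y
-- is applied to a Boolean combination of atoms and of already translated subformulas; after a case
-- split on the atoms depending on x alone and on whether y < x, y = x or y > x, its truth depends
-- only on y and, for each threshold atom "at least n occurrences of u between x and y", on that
-- count capped at n. Such capped counts are tracked in FO²[<, betfac] by jumping from x to the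
-- nearest position where an occurrence of a factor with a nonzero cap begins (or ends, on the
-- left), lowering that cap and recursing from there; the sum of the caps bounds the recursion.
-- Distances up to a bound, and occurrences of a factor at a given position, are themselves
-- expressible with ⟨u⟩: two positions are at least m + 1 apart iff some word of length m + 1
-- occurs strictly between them.

module Submission where

open import Defs
open import Data.Nat
  using (ℕ; zero; suc; >-nonZero; _+_; _∸_; _<_; _≤_; _≟_; _<?_; _≤?_; _⊓_; pred; s≤s; z≤n; _≤ᵇ_; _≡ᵇ_)
open import Data.Nat.Properties
open import Data.Fin using (Fin; toℕ; fromℕ<; _↑ˡ_; _↑ʳ_; splitAt)
import Data.Fin as Fin
open import Data.Fin.Properties using (toℕ-fromℕ<; toℕ<n; toℕ-injective; any?; splitAt-↑ˡ; splitAt-↑ʳ)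
open import Data.List using (List; []; _∷_; length; take; drop; filter; upTo)
import Data.List as List
import Data.List.Properties as List
open import Data.List.NonEmpty using (List⁺; _∷_; toList)
open import Data.List.Membership.Propositional using (_∈_)
open import Data.List.Membership.Propositional.Properties using (∈-filter⁺; ∈-filter⁻; ∈-upTo⁺)
open import Data.List.Relation.Unary.Any using (here)
open import Data.Vec using (Vec; []; _∷_; lookup; tabulate; sum)
open import Data.Vec.Properties using (lookup∘tabulate; tabulate-cong; tabulate∘lookup)
open import Data.Bool using (Bool; true; false; T; if_then_else_)
import Data.Bool as Bool
open import Data.Unit using (⊤; tt)
open import Data.Empty using (⊥; ⊥-elim)
open import Data.Product using (_×_; _,_; Σ; proj₁; proj₂)
open import Data.Product.Function.NonDependent.Propositional using (_×-⇔_)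
open import Data.Product.Function.Dependent.Propositional using (congˡ)
open import Function.Related.Propositional using (equivalence)
open import Data.Sum using (_⊎_; inj₁; inj₂; [_,_]′)
open import Relation.Nullary using (¬_; Dec; yes; no; does)
open import Relation.Nullary.Decidable using (_×-dec_; ¬?; map′; dec-true; does-⇔)
open import Relation.Binary.PropositionalEquality
  using (_≡_; refl; sym; trans; cong; cong₂; subst; subst₂; module ≡-Reasoning)
open import Relation.Binary.Definitions using (tri<; tri≈; tri>)
open import Function.Bundles using (_⇔_; mk⇔; Equivalence)
open import Function.Related.TypeIsomorphisms using (¬-cong-⇔)
import Function.Properties.Equivalence as ⇔
open import Level using (0ℓ)
import Relation.Binary.Reasoning.Setoid as SetoidReasoning
open import Algebra.Properties.CommutativeSemigroup +-commutativeSemigroup using (interchange)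

open Equivalence using (to; from)

module ⇔-Reasoning = SetoidReasoning (⇔.⇔-setoid 0ℓ)

Σ-⇔ : {A : Set} {B C : A → Set} → (∀ a → B a ⇔ C a) → Σ A B ⇔ Σ A C
Σ-⇔ e = congˡ {k = equivalence} (λ {a} → e a)

Interp : ℕ → Set → Set₁
Interp k P = (w : Word k) → P → ℕ → ℕ → Set

swapVar : Var → Var
swapVar vx = vy
swapVar vy = vx

module Assignments {k : ℕ} (w : Word k) where

  infixl 9 _[_↦_]
  _[_↦_] : Assign w → Var → Fin (length w) → Assign w
  ρ [ v ↦ i ] = update {w = w} ρ v i

  update-self : ∀ ρ v i → (ρ [ v ↦ i ]) v ≡ i
  update-self ρ vx i = refl
  update-self ρ vy i = refl

  update-cong : ∀ ρ ρ' u i v → (¬ v ≡ u → ρ v ≡ ρ' v) → (ρ [ u ↦ i ]) v ≡ (ρ' [ u ↦ i ]) v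
  update-cong ρ ρ' vx i vx h = refl
  update-cong ρ ρ' vx i vy h = h (λ ())
  update-cong ρ ρ' vy i vx h = h (λ ())
  update-cong ρ ρ' vy i vy h = refl

  update-twice : ∀ ρ v i j u → (ρ [ v ↦ i ] [ v ↦ j ]) u ≡ (ρ [ v ↦ j ]) u
  update-twice ρ vx i j vx = refl
  update-twice ρ vx i j vy = refl
  update-twice ρ vy i j vx = refl
  update-twice ρ vy i j vy = refl

  update-swapVar : ∀ ρ v i → (ρ [ swapVar v ↦ i ]) v ≡ ρ v
  update-swapVar ρ vx i = refl
  update-swapVar ρ vy i = refl

  swapAssign : Assign w → Assign w
  swapAssign ρ v = ρ (swapVar v)

  update-swap : ∀ ρ u i v → (ρ [ swapVar u ↦ i ]) (swapVar v) ≡ (swapAssign ρ [ u ↦ i ]) v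
  update-swap ρ vx i vx = refl
  update-swap ρ vx i vy = refl
  update-swap ρ vy i vx = refl
  update-swap ρ vy i vy = refl

Free-∃ : ∀ {k P} v u (φ : FO2 k P) → ¬ v ≡ u → Free v φ → Free v (∃' u φ)
Free-∃ v u φ v≢u f with v ≟v u
... | yes v≡u = ⊥-elim (v≢u v≡u)
... | no _ = f

swapFormula : ∀ {k P} → FO2 k P → FO2 k P
swapFormula (letter a v) = letter a (swapVar v)
swapFormula (u ≐ u') = swapVar u ≐ swapVar u'
swapFormula (u ≺ u') = swapVar u ≺ swapVar u'
swapFormula (bin p u u') = bin p (swapVar u) (swapVar u')
swapFormula (¬' φ) = ¬' swapFormula φ
swapFormula (φ ∧' ψ) = swapFormula φ ∧' swapFormula ψ
swapFormula (∃' u φ) = ∃' (swapVar u) (swapFormula φ)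

module _ {k : ℕ} {P : Set} (I : Interp k P) (w : Word k) where

  open Assignments w

  Agree : FO2 k P → Assign w → Assign w → Set
  Agree φ ρ ρ' = ∀ v → Free v φ → ρ v ≡ ρ' v

  Sat-agree : ∀ φ ρ ρ' → Agree φ ρ ρ' → Sat I w ρ φ → Sat I w ρ' φ
  Sat-agree (letter a v) ρ ρ' ag s = trans (cong (List.lookup w) (sym (ag v refl))) s
  Sat-agree (u ≐ u') ρ ρ' ag s = trans (sym (ag u (inj₁ refl))) (trans s (ag u' (inj₂ refl)))
  Sat-agree (u ≺ u') ρ ρ' ag s rewrite sym (ag u (inj₁ refl)) | sym (ag u' (inj₂ refl)) = s
  Sat-agree (bin p u u') ρ ρ' ag s rewrite sym (ag u (inj₁ refl)) | sym (ag u' (inj₂ refl)) = s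
  Sat-agree (¬' φ) ρ ρ' ag s s' = s (Sat-agree φ ρ' ρ (λ v f → sym (ag v f)) s')
  Sat-agree (φ ∧' ψ) ρ ρ' ag (s , s') =
    Sat-agree φ ρ ρ' (λ v f → ag v (inj₁ f)) s , Sat-agree ψ ρ ρ' (λ v f → ag v (inj₂ f)) s'
  Sat-agree (∃' u φ) ρ ρ' ag (i , s) =
    i , Sat-agree φ _ _ (λ v f → update-cong ρ ρ' u i v (λ v≢u → ag v (Free-∃ v u φ v≢u f))) s

  Sat-ext : ∀ φ ρ ρ' → (∀ v → ρ v ≡ ρ' v) → Sat I w ρ φ ⇔ Sat I w ρ' φ
  Sat-ext φ ρ ρ' e = mk⇔ (Sat-agree φ ρ ρ' (λ v _ → e v)) (Sat-agree φ ρ' ρ (λ v _ → sym (e v)))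

  Sat? : (∀ w p x y → Dec (I w p x y)) → ∀ ρ φ → Dec (Sat I w ρ φ)
  Sat? I? ρ (letter a v) = List.lookup w (ρ v) Fin.≟ a
  Sat? I? ρ (u ≐ u') = ρ u Fin.≟ ρ u'
  Sat? I? ρ (u ≺ u') = toℕ (ρ u) <? toℕ (ρ u')
  Sat? I? ρ (bin p u u') = I? w p _ _
  Sat? I? ρ (¬' φ) = ¬? (Sat? I? ρ φ)
  Sat? I? ρ (φ ∧' ψ) = Sat? I? ρ φ ×-dec Sat? I? ρ ψ
  Sat? I? ρ (∃' u φ) = any? (λ i → Sat? I? (ρ [ u ↦ i ]) φ)

  Sat-swap : ∀ (φ : FO2 k P) ρ → Sat I w ρ (swapFormula φ) ⇔ Sat I w (swapAssign ρ) φ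
  Sat-swap (letter a v) ρ = ⇔.refl
  Sat-swap (u ≐ u') ρ = ⇔.refl
  Sat-swap (u ≺ u') ρ = ⇔.refl
  Sat-swap (bin p u u') ρ = ⇔.refl
  Sat-swap (¬' φ) ρ = ¬-cong-⇔ (Sat-swap φ ρ)
  Sat-swap (φ ∧' ψ) ρ = Sat-swap φ ρ ×-⇔ Sat-swap ψ ρ
  Sat-swap (∃' u φ) ρ = Σ-⇔ λ i →
    ⇔.trans (Sat-swap φ (ρ [ swapVar u ↦ i ])) (Sat-ext φ _ _ (update-swap ρ u i))

⊤F ⊥F : ∀ {k P} → FO2 k P
⊤F = ∃' vx (vx ≐ vx)
⊥F = ¬' ⊤F

_∨F_ : ∀ {k P} → FO2 k P → FO2 k P → FO2 k P
A ∨F B = ¬' ((¬' A) ∧' (¬' B))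

constF : ∀ {k P} → Bool → FO2 k P
constF true = ⊤F
constF false = ⊥F

literal : ∀ {k P} → Bool → FO2 k P → FO2 k P
literal true A = A
literal false A = ¬' A

whenPositive : ∀ {k P} → ℕ → FO2 k P → FO2 k P
whenPositive zero A = ⊤F
whenPositive (suc _) A = A

OrFin : ∀ {k P} (n : ℕ) → (Fin n → FO2 k P) → FO2 k P
OrFin zero f = ⊥F
OrFin (suc n) f = f Fin.zero ∨F OrFin n (λ i → f (Fin.suc i))

AndFin : ∀ {k P} (n : ℕ) → (Fin n → FO2 k P) → FO2 k P
AndFin zero f = ⊤F
AndFin (suc n) f = f Fin.zero ∧' AndFin n (λ i → f (Fin.suc i))

OrWords : ∀ {k P} (m : ℕ) → (List (Fin k) → FO2 k P) → FO2 k P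
OrWords zero f = f []
OrWords {k} (suc m) f = OrFin k (λ a → OrWords m (λ v → f (a ∷ v)))

OrBools : ∀ {k P} (n : ℕ) → (Vec Bool n → FO2 k P) → FO2 k P
OrBools zero f = f []
OrBools (suc n) f = OrBools n (λ π → f (true ∷ π)) ∨F OrBools n (λ π → f (false ∷ π))

module _ {k : ℕ} {P : Set} (I : Interp k P) (w : Word k) (ρ : Assign w) where

  Sat-⊤ : Sat I w ρ ⊤F
  Sat-⊤ = ρ vx , refl

  Sat-constF : ∀ b → Sat I w ρ (constF b) ⇔ T b
  Sat-constF true = mk⇔ _ (λ _ → Sat-⊤)
  Sat-constF false = mk⇔ (λ s → s Sat-⊤) λ ()

  Sat-whenPositive : ∀ n A → Sat I w ρ (whenPositive n A) ⇔ (1 ≤ n → Sat I w ρ A)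
  Sat-whenPositive zero A = mk⇔ (λ _ ()) (λ _ → Sat-⊤)
  Sat-whenPositive (suc n) A = mk⇔ (λ s _ → s) (λ h → h (s≤s z≤n))

  Sat-AndFin : ∀ n f → Sat I w ρ (AndFin n f) ⇔ (∀ i → Sat I w ρ (f i))
  Sat-AndFin zero f = mk⇔ (λ _ ()) (λ _ → Sat-⊤)
  Sat-AndFin (suc n) f = mk⇔
    (λ { (s , ss) Fin.zero → s ; (s , ss) (Fin.suc i) → to IH ss i })
    (λ h → h Fin.zero , from IH (λ i → h (Fin.suc i)))
    where IH = Sat-AndFin n (λ i → f (Fin.suc i))

  Sat-if : ∀ {A : Set} (A? : Dec A) X → Sat I w ρ (if does A? then X else ⊥F) ⇔ (A × Sat I w ρ X)
  Sat-if (yes a) X = mk⇔ (a ,_) proj₂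
  Sat-if (no ¬a) X = mk⇔ (λ s → ⊥-elim (s Sat-⊤)) (λ (a , _) → ⊥-elim (¬a a))

  Sat-literal : ∀ A {Q : Set} (Q? : Dec Q) → (Sat I w ρ A ⇔ Q) → Sat I w ρ (literal (does Q?) A)
  Sat-literal A (yes q) e = from e q
  Sat-literal A (no ¬q) e = λ s → ¬q (to e s)

  literal-does : ∀ A {Q : Set} (Q? : Dec Q) → (Sat I w ρ A ⇔ Q) → ∀ b → Sat I w ρ (literal b A) → b ≡ does Q?
  literal-does A (yes q) e true s = refl
  literal-does A (yes q) e false s = ⊥-elim (s (from e q))
  literal-does A (no ¬q) e true s = ⊥-elim (¬q (to e s))
  literal-does A (no ¬q) e false s = refl

  Sat-literal⇔ : ∀ A {Q : Set} (Q? : Dec Q) → (Sat I w ρ A ⇔ Q) →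
    ∀ b → Sat I w ρ (literal b A) ⇔ (b ≡ does Q?)
  Sat-literal⇔ A Q? e b = mk⇔ (literal-does A Q? e b) (λ { refl → Sat-literal A Q? e })

-- Semantics of FO²[<, betfac] is decidable, so disjunction is classical

betfac? : ∀ {k} (w : Word k) (u : Betfac k) (x y : ℕ) → Dec (betfacI w u x y)
betfac? w u@(_ ∷ _) x y = map′ (λ (i , o) → toℕ i , o) witness (any? {n = y} (λ i → occBetween? u w x y (toℕ i)))
  where
  witness : betfacI w u x y → _
  witness (z , o@(_ , z+|u|≤y , _)) =
    fromℕ< (<-≤-trans (m<m+n z (s≤s z≤n)) z+|u|≤y) , subst (OccBetween u w x y) (sym (toℕ-fromℕ< _)) o

module _ {k : ℕ} (w : Word k) (ρ : Assign w) where

  SatBet? : ∀ φ → Dec (SatBet w ρ φ)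
  SatBet? = Sat? betfacI w (λ w p x y → betfac? w p x y) ρ

  SatBet-∨ : ∀ A B → SatBet w ρ (A ∨F B) ⇔ (SatBet w ρ A ⊎ SatBet w ρ B)
  SatBet-∨ A B = mk⇔ (λ s → decide (SatBet? A) (SatBet? B) s) λ where
      (inj₁ a) (¬a , ¬b) → ¬a a
      (inj₂ b) (¬a , ¬b) → ¬b b
    where
    decide : Dec (SatBet w ρ A) → Dec (SatBet w ρ B) → SatBet w ρ (A ∨F B) → SatBet w ρ A ⊎ SatBet w ρ B
    decide (yes a) _ s = inj₁ a
    decide (no _) (yes b) s = inj₂ b
    decide (no ¬a) (no ¬b) s = ⊥-elim (s (¬a , ¬b))

  SatBet-OrFin : ∀ n f → SatBet w ρ (OrFin n f) ⇔ Σ (Fin n) (λ i → SatBet w ρ (f i))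
  SatBet-OrFin zero f = mk⇔ (λ s → ⊥-elim (s (Sat-⊤ betfacI w ρ))) (λ ())
  SatBet-OrFin (suc n) f = mk⇔
    (λ s → [ (λ a → Fin.zero , a) , (λ b → let (i , c) = to IH b in Fin.suc i , c) ]′ (to ∨-sem s))
    (λ { (Fin.zero , a) → from ∨-sem (inj₁ a) ; (Fin.suc i , a) → from ∨-sem (inj₂ (from IH (i , a))) })
    where
    IH = SatBet-OrFin n (λ i → f (Fin.suc i))
    ∨-sem = SatBet-∨ (f Fin.zero) (OrFin n (λ i → f (Fin.suc i)))

  SatBet-OrWords : ∀ m f → SatBet w ρ (OrWords m f) ⇔ Σ (List (Fin k)) (λ v → (length v ≡ m) × SatBet w ρ (f v))
  SatBet-OrWords zero f = mk⇔ (λ s → [] , refl , s) (λ { ([] , refl , s) → s })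
  SatBet-OrWords (suc m) f = mk⇔
    (λ s → let (a , s') = to heads s ; (v , e , s'') = to (IH a) s' in a ∷ v , cong suc e , s'')
    (λ { (a ∷ v , e , s) → from heads (a , from (IH a) (v , suc-injective e , s)) })
    where
    heads = SatBet-OrFin k (λ a → OrWords m (λ v → f (a ∷ v)))
    IH = λ a → SatBet-OrWords m (λ v → f (a ∷ v))

  SatBet-OrBools : ∀ n f → SatBet w ρ (OrBools n f) ⇔ Σ (Vec Bool n) (λ π → SatBet w ρ (f π))
  SatBet-OrBools zero f = mk⇔ (λ s → [] , s) (λ { ([] , s) → s })
  SatBet-OrBools (suc n) f = mk⇔
    (λ s → [ (λ a → let (π , b) = to IHᵗ a in true ∷ π , b)
           , (λ a → let (π , b) = to IHᶠ a in false ∷ π , b) ]′ (to ∨-sem s))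
    (λ { (true ∷ π , s) → from ∨-sem (inj₁ (from IHᵗ (π , s)))
       ; (false ∷ π , s) → from ∨-sem (inj₂ (from IHᶠ (π , s))) })
    where
    IHᵗ = SatBet-OrBools n (λ π → f (true ∷ π))
    IHᶠ = SatBet-OrBools n (λ π → f (false ∷ π))
    ∨-sem = SatBet-∨ (OrBools n (λ π → f (true ∷ π))) (OrBools n (λ π → f (false ∷ π)))

-- Distances and factor occurrences are definable in FO²[<, betfac]

lookup∷drop : ∀ {k} (w : Word k) (i : Fin (length w)) → drop (toℕ i) w ≡ List.lookup w i ∷ drop (suc (toℕ i)) w
lookup∷drop (a ∷ w) Fin.zero = refl
lookup∷drop (a ∷ w) (Fin.suc i) = lookup∷drop w i

OccursAt⇒< : ∀ {k} (u : List⁺ (Fin k)) (w : Word k) z → OccursAt u w z → z < length w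
OccursAt⇒< (a ∷ as) [] zero ()
OccursAt⇒< (a ∷ as) [] (suc z) ()
OccursAt⇒< u (c ∷ w) zero o = s≤s z≤n
OccursAt⇒< u (c ∷ w) (suc z) o = s≤s (OccursAt⇒< u w z o)

OccursAt-∷ : ∀ {k} (a : Fin k) as (w : Word k) (i : Fin (length w)) →
  OccursAt (a ∷ as) w (toℕ i) ⇔ ((List.lookup w i ≡ a) × (take (length as) (drop (suc (toℕ i)) w) ≡ as))
OccursAt-∷ a as w i rewrite lookup∷drop w i = mk⇔ List.∷-injective (λ (e , e') → cong₂ _∷_ e e')

factorAt : ∀ {k} (w : Word k) z m → z + suc m ≤ length w →
  Σ (List⁺ (Fin k)) λ u → (length (toList u) ≡ suc m) × OccursAt u w z
factorAt (c ∷ cs) zero m (s≤s le) = c ∷ take m cs , cong suc |take| , occurs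
  where
  |take| : length (take m cs) ≡ m
  |take| = trans (List.length-take m cs) (m≤n⇒m⊓n≡m le)
  occurs : take (length (toList (c ∷ take m cs))) (c ∷ cs) ≡ c ∷ take m cs
  occurs rewrite |take| = refl
factorAt (c ∷ cs) (suc z) m (s≤s le) = factorAt cs z m le

+<⇔<∸ : ∀ a m b → (a + m < b) ⇔ (m < b ∸ a)
+<⇔<∸ a m b = mk⇔
  (λ lt → m+n≤o⇒m≤o∸n (suc m) (subst (_≤ b) (cong suc (+-comm a m)) lt))
  (λ lt → subst (_≤ b) (cong suc (+-comm m a)) (m≤o∸n⇒m+n≤o (suc m) (a≤b lt) lt))
  where
  a≤b : m < b ∸ a → a ≤ b
  a≤b lt = <⇒≤ (m∸n≢0⇒n<m (λ e → <⇒≢ (≤-trans (s≤s z≤n) lt) (sym e)))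

gapAtLeast : ∀ {k} → ℕ → Var → Var → FOBet k
gapAtLeast zero a b = a ≺ b
gapAtLeast {k} (suc m) a b = OrFin k (λ c → OrWords m (λ v → bin (c ∷ v) a b))

succF : ∀ {k} → Var → Var → FOBet k
succF a b = (a ≺ b) ∧' (¬' gapAtLeast 1 a b)

occursAtF′ : ∀ {k} → Var → Fin k → List (Fin k) → FOBet k
occursAtF′ v a [] = letter a v
occursAtF′ v a (b ∷ bs) = letter a v ∧' ∃' (swapVar v) (succF v (swapVar v) ∧' occursAtF′ (swapVar v) b bs)

occursAtF : ∀ {k} → Var → List⁺ (Fin k) → FOBet k
occursAtF v (a ∷ as) = occursAtF′ v a as

distanceIs : ∀ {k} → ℕ → Var → Var → FOBet k
distanceIs e a b = gapAtLeast e a b ∧' (¬' gapAtLeast (suc e) a b)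

-- Distances are observed only up to the cap D: the value suc i < D is exact, suc i = D means "at least D".
cappedDistanceIs : ∀ {k} (D i : ℕ) → Var → Var → FOBet k
cappedDistanceIs D i a b with suc i <? D
... | yes _ = distanceIs i a b
... | no _ = gapAtLeast i a b

withCappedDistance : ∀ {k} (D : ℕ) → Var → Var → (ℕ → FOBet k) → FOBet k
withCappedDistance D a b f = OrFin D (λ i → cappedDistanceIs D (toℕ i) a b ∧' f (suc (toℕ i)))

⊓-≡-below : ∀ d D i → suc i < D → (d ≡ suc i) ⇔ (d ⊓ D ≡ suc i)
⊓-≡-below d D i i<D = mk⇔ (λ { refl → m≤n⇒m⊓n≡m (<⇒≤ i<D) }) capped
  where
  capped : d ⊓ D ≡ suc i → d ≡ suc i
  capped e with ≤-total d D
  ... | inj₁ d≤D = trans (sym (m≤n⇒m⊓n≡m d≤D)) e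
  ... | inj₂ D≤d = ⊥-elim (<-irrefl (sym (trans (sym (m≥n⇒m⊓n≡n D≤d)) e)) i<D)

⊓-≡-cap : ∀ d i → (i < d) ⇔ (d ⊓ suc i ≡ suc i)
⊓-≡-cap d i = mk⇔ m≥n⇒m⊓n≡n m⊓n≡n⇒n≤m

module _ {k : ℕ} (w : Word k) where

  open Assignments w

  SatBet-gapAtLeast : ∀ ρ m a b → SatBet w ρ (gapAtLeast m a b) ⇔ (toℕ (ρ a) + m < toℕ (ρ b))
  SatBet-gapAtLeast ρ zero a b =
    mk⇔ (subst (_< toℕ (ρ b)) (sym (+-identityʳ _))) (subst (_< toℕ (ρ b)) (+-identityʳ _))
  SatBet-gapAtLeast ρ (suc m) a b = mk⇔ gap factor
    where
    pa = toℕ (ρ a)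
    pb = toℕ (ρ b)
    gap : SatBet w ρ (gapAtLeast (suc m) a b) → pa + suc m < pb
    gap s with to (SatBet-OrFin w ρ k _) s
    ... | c , s' with to (SatBet-OrWords w ρ m (λ v → bin (c ∷ v) a b)) s'
    ... | v , refl , (z , pa<z , z+|u|≤pb , _) = <-≤-trans (+-monoˡ-< (suc (length v)) pa<z) z+|u|≤pb
    factor : pa + suc m < pb → SatBet w ρ (gapAtLeast (suc m) a b)
    factor lt with factorAt w (suc pa) m (≤-trans lt (<⇒≤ (toℕ<n (ρ b))))
    ... | c ∷ v , e , o = from (SatBet-OrFin w ρ k _) (c , from (SatBet-OrWords w ρ m (λ v → bin (c ∷ v) a b))
            (v , suc-injective e , suc pa , ≤-refl , subst (λ q → suc pa + q ≤ pb) (sym e) lt , o))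

  SatBet-gapAtLeast-∸ : ∀ ρ m a b → SatBet w ρ (gapAtLeast m a b) ⇔ (m < toℕ (ρ b) ∸ toℕ (ρ a))
  SatBet-gapAtLeast-∸ ρ m a b = ⇔.trans (SatBet-gapAtLeast ρ m a b) (+<⇔<∸ _ m _)

  SatBet-succF : ∀ ρ a b → SatBet w ρ (succF a b) ⇔ (toℕ (ρ b) ≡ suc (toℕ (ρ a)))
  SatBet-succF ρ a b = mk⇔ succ (λ e → a<b e , λ s → <-irrefl (sym e) (subst (_< pb) (+-comm pa 1) (to gap₁ s)))
    where
    pa = toℕ (ρ a)
    pb = toℕ (ρ b)
    gap₁ = SatBet-gapAtLeast ρ 1 a b
    a<b : pb ≡ suc pa → pa < pb
    a<b e = subst (pa <_) (sym e) ≤-refl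
    succ : SatBet w ρ (succF a b) → pb ≡ suc pa
    succ (lt , ¬gap) with <-cmp pb (suc pa)
    ... | tri< l _ _ = ⊥-elim (<-irrefl refl (≤-trans lt (≤-pred l)))
    ... | tri≈ _ e _ = e
    ... | tri> _ _ g = ⊥-elim (¬gap (from gap₁ (subst (_< pb) (+-comm 1 pa) g)))

  SatBet-occursAtF′ : ∀ ρ v a as → SatBet w ρ (occursAtF′ v a as) ⇔ OccursAt (a ∷ as) w (toℕ (ρ v))
  SatBet-occursAtF′ ρ v a [] =
    mk⇔ (λ e → from (OccursAt-∷ a [] w (ρ v)) (e , refl)) (λ o → proj₁ (to (OccursAt-∷ a [] w (ρ v)) o))
  SatBet-occursAtF′ ρ v a (b ∷ bs) = mk⇔ occurs formula
    where
    v′ = swapVar v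
    next : ∀ j → SatBet w (ρ [ v′ ↦ j ]) (succF v v′) ⇔ (toℕ j ≡ suc (toℕ (ρ v)))
    next j = subst₂ (λ p q → SatBet w (ρ [ v′ ↦ j ]) (succF v v′) ⇔ (toℕ p ≡ suc (toℕ q)))
               (update-self ρ v′ j) (update-swapVar ρ v j) (SatBet-succF (ρ [ v′ ↦ j ]) v v′)
    rest : ∀ j → SatBet w (ρ [ v′ ↦ j ]) (occursAtF′ v′ b bs) ⇔ OccursAt (b ∷ bs) w (toℕ j)
    rest j = subst (λ p → SatBet w (ρ [ v′ ↦ j ]) (occursAtF′ v′ b bs) ⇔ OccursAt (b ∷ bs) w (toℕ p))
               (update-self ρ v′ j) (SatBet-occursAtF′ (ρ [ v′ ↦ j ]) v′ b bs)
    occurs : SatBet w ρ (occursAtF′ v a (b ∷ bs)) → OccursAt (a ∷ b ∷ bs) w (toℕ (ρ v))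
    occurs (e , j , sc , s) =
      from (OccursAt-∷ a (b ∷ bs) w (ρ v)) (e , subst (OccursAt (b ∷ bs) w) (to (next j) sc) (to (rest j) s))
    formula : OccursAt (a ∷ b ∷ bs) w (toℕ (ρ v)) → SatBet w ρ (occursAtF′ v a (b ∷ bs))
    formula o with to (OccursAt-∷ a (b ∷ bs) w (ρ v)) o
    ... | e , o′ = e , j , from (next j) j≡ , from (rest j) (subst (OccursAt (b ∷ bs) w) (sym j≡) o′)
      where
      j = fromℕ< (OccursAt⇒< (b ∷ bs) w _ o′)
      j≡ = toℕ-fromℕ< (OccursAt⇒< (b ∷ bs) w _ o′)

  SatBet-occursAtF : ∀ ρ v u → SatBet w ρ (occursAtF v u) ⇔ OccursAt u w (toℕ (ρ v))
  SatBet-occursAtF ρ v (a ∷ as) = SatBet-occursAtF′ ρ v a as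

  SatBet-distanceIs : ∀ ρ e a b → SatBet w ρ (distanceIs e a b) ⇔ (toℕ (ρ b) ∸ toℕ (ρ a) ≡ suc e)
  SatBet-distanceIs ρ e a b = mk⇔
    (λ (s , ¬s) → ≤-antisym (≮⇒≥ (λ l → ¬s (from (gap (suc e)) l))) (to (gap e) s))
    (λ eq → from (gap e) (subst (e <_) (sym eq) ≤-refl) , λ s → <-irrefl (sym eq) (to (gap (suc e)) s))
    where gap = λ m → SatBet-gapAtLeast-∸ ρ m a b

  SatBet-cappedDistanceIs : ∀ ρ D i a b → i < D →
    SatBet w ρ (cappedDistanceIs D i a b) ⇔ ((toℕ (ρ b) ∸ toℕ (ρ a)) ⊓ D ≡ suc i)
  SatBet-cappedDistanceIs ρ D i a b i<D with suc i <? D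
  ... | yes i+1<D = ⇔.trans (SatBet-distanceIs ρ i a b) (⊓-≡-below _ D i i+1<D)
  ... | no i+1≮D = subst (λ D → SatBet w ρ (gapAtLeast i a b) ⇔ ((toℕ (ρ b) ∸ toℕ (ρ a)) ⊓ D ≡ suc i))
                     (≤-antisym i<D (≮⇒≥ i+1≮D)) (⇔.trans (SatBet-gapAtLeast-∸ ρ i a b) (⊓-≡-cap _ i))

  SatBet-withCappedDistance : ∀ ρ D a b f → 1 ≤ D → toℕ (ρ a) < toℕ (ρ b) →
    SatBet w ρ (withCappedDistance D a b f) ⇔ SatBet w ρ (f ((toℕ (ρ b) ∸ toℕ (ρ a)) ⊓ D))
  SatBet-withCappedDistance ρ D a b f 1≤D a<b = mk⇔ select pick
    where
    d = toℕ (ρ b) ∸ toℕ (ρ a)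
    cases = SatBet-OrFin w ρ D (λ i → cappedDistanceIs D (toℕ i) a b ∧' f (suc (toℕ i)))
    select : _ → _
    select s with to cases s
    ... | i , s₁ , s₂ =
      subst (λ q → SatBet w ρ (f q)) (sym (to (SatBet-cappedDistanceIs ρ D (toℕ i) a b (toℕ<n i)) s₁)) s₂
    1≤d⊓D : 1 ≤ d ⊓ D
    1≤d⊓D = ⊓-glb (m<n⇒0<n∸m a<b) 1≤D
    i<D : pred (d ⊓ D) < D
    i<D = subst (_≤ D) (sym (suc-pred (d ⊓ D) {{>-nonZero 1≤d⊓D}})) (m⊓n≤n d D)
    d⊓D≡ : d ⊓ D ≡ suc (toℕ (fromℕ< i<D))
    d⊓D≡ = trans (sym (suc-pred (d ⊓ D) {{>-nonZero 1≤d⊓D}})) (cong suc (sym (toℕ-fromℕ< i<D)))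
    pick : _ → _
    pick s = from cases (fromℕ< i<D , from (SatBet-cappedDistanceIs ρ D _ a b (toℕ<n _)) d⊓D≡ ,
                         subst (λ q → SatBet w ρ (f q)) d⊓D≡ s)

indicator : ∀ {A : Set} → Dec A → ℕ
indicator (yes _) = 1
indicator (no _) = 0

count : ∀ {P : ℕ → Set} → (∀ z → Dec (P z)) → ℕ → ℕ
count P? zero = 0
count P? (suc n) = indicator (P? 0) + count (λ z → P? (suc z)) n

count-filter : ∀ {P : ℕ → Set} (P? : ∀ z → Dec (P z)) (g : ℕ → ℕ) n →
  length (filter P? (List.applyUpTo g n)) ≡ count (λ z → P? (g z)) n
count-filter P? g zero = refl
count-filter P? g (suc n) with P? (g 0)
... | yes _ = cong suc (count-filter P? (λ z → g (suc z)) n)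
... | no _ = count-filter P? (λ z → g (suc z)) n

count-zero : ∀ {P : ℕ → Set} (P? : ∀ z → Dec (P z)) n → (∀ z → z < n → ¬ P z) → count P? n ≡ 0
count-zero P? zero f = refl
count-zero P? (suc n) f with P? 0
... | yes p = ⊥-elim (f 0 (s≤s z≤n) p)
... | no _ = count-zero (λ z → P? (suc z)) n (λ z l → f (suc z) (s≤s l))

count-single : ∀ {P : ℕ → Set} (P? : ∀ z → Dec (P z)) n s → s < n → P s → (∀ z → P z → z ≡ s) →
  count P? n ≡ 1
count-single P? (suc n) zero l p u with P? 0
... | yes _ = cong suc (count-zero (λ z → P? (suc z)) n (λ z _ q → 0≢1+n (sym (u (suc z) q))))
... | no ¬p = ⊥-elim (¬p p)
count-single P? (suc n) (suc s) (s≤s l) p u with P? 0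
... | yes q = ⊥-elim (0≢1+n (u 0 q))
... | no _ = count-single (λ z → P? (suc z)) n s l p (λ z q → suc-injective (u (suc z) q))

count-pos⇒witness : ∀ {P : ℕ → Set} (P? : ∀ z → Dec (P z)) n → 1 ≤ count P? n → Σ ℕ λ z → z < n × P z
count-pos⇒witness P? (suc n) c with P? 0
... | yes p = 0 , s≤s z≤n , p
... | no _ with count-pos⇒witness (λ z → P? (suc z)) n c
... | z , l , p = suc z , s≤s l , p

witness⇒count-pos : ∀ {P : ℕ → Set} (P? : ∀ z → Dec (P z)) n s → s < n → P s → 1 ≤ count P? n
witness⇒count-pos P? (suc n) s l p with P? 0
... | yes _ = s≤s z≤n
witness⇒count-pos P? (suc n) zero l p | no ¬p = ⊥-elim (¬p p)
witness⇒count-pos P? (suc n) (suc s) (s≤s l) p | no _ = witness⇒count-pos (λ z → P? (suc z)) n s l p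

least-witness : ∀ {P : ℕ → Set} → (∀ z → Dec (P z)) → ∀ t → P t →
  Σ ℕ λ s → (s ≤ t) × (P s × (∀ t' → t' < s → ¬ P t'))
least-witness {P} P? t p = search (suc t) 0 (λ _ ()) (s≤s ≤-refl)
  where
  search : ∀ fuel i → (∀ t' → t' < i → ¬ P t') → t < i + fuel →
    Σ ℕ λ s → (s ≤ t) × (P s × (∀ t' → t' < s → ¬ P t'))
  search zero i below t<i = ⊥-elim (below t (subst (t <_) (+-identityʳ i) t<i) p)
  search (suc f) i below t<i+f with P? i
  ... | yes q = i , ≮⇒≥ (λ t<i → below t t<i p) , q , below
  ... | no ¬q = search f (suc i) below′ (subst (t <_) (+-suc i f) t<i+f)
    where
    below′ : ∀ t' → t' < suc i → ¬ P t'
    below′ t' l with m≤n⇒m<n∨m≡n (≤-pred l)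
    ... | inj₁ lt = below t' lt
    ... | inj₂ refl = ¬q

greatest-witness : ∀ {P : ℕ → Set} → (∀ z → Dec (P z)) → ∀ b t → t < b → P t →
  Σ ℕ λ s → (t ≤ s) × ((s < b) × (P s × (∀ t' → s < t' → t' < b → ¬ P t')))
greatest-witness {P} P? b t t<b p = search (b ∸ suc t) (≤-reflexive b≡) above₀
  where
  b≡ : suc t + (b ∸ suc t) ≡ b
  b≡ = m+[n∸m]≡n t<b
  above₀ : ∀ t' → t + (b ∸ suc t) < t' → t' < b → ¬ P t'
  above₀ t' l₁ l₂ _ = <-irrefl refl (<-≤-trans l₂ (subst (_≤ t') b≡ l₁))
  search : ∀ f → t + f < b → (∀ t' → t + f < t' → t' < b → ¬ P t') →
    Σ ℕ λ s → (t ≤ s) × ((s < b) × (P s × (∀ t' → s < t' → t' < b → ¬ P t')))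
  search f l above with P? (t + f)
  ... | yes q = t + f , m≤m+n t f , l , q , above
  search zero l above | no ¬q = ⊥-elim (¬q (subst P (sym (+-identityʳ t)) p))
  search (suc f) l above | no ¬q = search f (<-trans (+-monoʳ-< t ≤-refl) l) above′
    where
    above′ : ∀ t' → t + f < t' → t' < b → ¬ P t'
    above′ t' l₁ l₂ with m≤n⇒m<n∨m≡n l₁
    ... | inj₁ lt = above t' (subst (_< t') (sym (+-suc t f)) lt) l₂
    ... | inj₂ e = λ q → ¬q (subst P (sym (trans (+-suc t f) e)) q)

indicator-union : ∀ {A B C : Set} (a : Dec A) (b : Dec B) (c : Dec C) →
  (A → B ⊎ C) → (B → A) → (C → A) → (B → ¬ C) → indicator a ≡ indicator b + indicator c
indicator-union (yes p) (yes q) (yes r) f g h d = ⊥-elim (d q r)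
indicator-union (yes p) (yes q) (no r) f g h d = refl
indicator-union (yes p) (no q) (yes r) f g h d = refl
indicator-union (yes p) (no q) (no r) f g h d = ⊥-elim ([ q , r ]′ (f p))
indicator-union (no p) (yes q) c f g h d = ⊥-elim (p (g q))
indicator-union (no p) (no q) (yes r) f g h d = ⊥-elim (p (h r))
indicator-union (no p) (no q) (no r) f g h d = refl

count-union : ∀ {P Q R : ℕ → Set} (P? : ∀ z → Dec (P z)) (Q? : ∀ z → Dec (Q z)) (R? : ∀ z → Dec (R z)) n →
  (∀ z → P z → Q z ⊎ R z) → (∀ z → Q z → P z) → (∀ z → R z → P z) → (∀ z → Q z → ¬ R z) →
  count P? n ≡ count Q? n + count R? n
count-union P? Q? R? zero f g h d = refl
count-union P? Q? R? (suc n) f g h d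
  rewrite indicator-union (P? 0) (Q? 0) (R? 0) (f 0) (g 0) (h 0) (d 0)
        | count-union (λ z → P? (suc z)) (λ z → Q? (suc z)) (λ z → R? (suc z)) n
            (λ z → f (suc z)) (λ z → g (suc z)) (λ z → h (suc z)) (λ z → d (suc z))
  = interchange (indicator (Q? 0)) (indicator (R? 0)) _ _

len⁺ : ∀ {k} → List⁺ (Fin k) → ℕ
len⁺ u = length (toList u)

1≤len⁺ : ∀ {k} (u : List⁺ (Fin k)) → 1 ≤ len⁺ u
1≤len⁺ (a ∷ as) = s≤s z≤n

occursAt? : ∀ {k} (u : List⁺ (Fin k)) (w : Word k) z → Dec (OccursAt u w z)
occursAt? u w z = List.≡-dec Fin._≟_ (take (len⁺ u) (drop z w)) (toList u)

module _ {k : ℕ} (u : List⁺ (Fin k)) (w : Word k) where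

  occCount≡count : ∀ x y → occCount u w x y ≡ count (occBetween? u w x y) (length w)
  occCount≡count x y = count-filter (occBetween? u w x y) (λ z → z) (length w)

  occCount-short : ∀ x y → y ≤ x + len⁺ u → occCount u w x y ≡ 0
  occCount-short x y y≤x+|u| = trans (occCount≡count x y) (count-zero (occBetween? u w x y) (length w)
    (λ z _ (x<z , z+|u|≤y , _) → <-irrefl refl (≤-trans (+-monoˡ-< (len⁺ u) x<z) (≤-trans z+|u|≤y y≤x+|u|))))

  betfac⇒occCount-pos : ∀ x y → y ≤ length w → betfacI w u x y → 1 ≤ occCount u w x y
  betfac⇒occCount-pos x y y≤|w| (z , occ@(_ , z+|u|≤y , _)) rewrite occCount≡count x y =
    witness⇒count-pos (occBetween? u w x y) (length w) z
      (≤-trans (<-≤-trans (m<m+n z (1≤len⁺ u)) z+|u|≤y) y≤|w|) occ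

  occCount-pos⇒betfac : ∀ x y → 1 ≤ occCount u w x y → betfacI w u x y
  occCount-pos⇒betfac x y c rewrite occCount≡count x y with count-pos⇒witness (occBetween? u w x y) (length w) c
  ... | z , _ , occ = z , occ

  ¬betfac⇒occCount≡0 : ∀ x y → ¬ betfacI w u x y → occCount u w x y ≡ 0
  ¬betfac⇒occCount≡0 x y ¬occ =
    trans (occCount≡count x y) (count-zero (occBetween? u w x y) (length w) (λ z _ occ → ¬occ (z , occ)))

  StartsAt : ℕ → ℕ → ℕ → Set
  StartsAt s y z = (z ≡ s) × (OccursAt u w z × (z + len⁺ u ≤ y))

  startsAt? : ∀ s y z → Dec (StartsAt s y z)
  startsAt? s y z = (z ≟ s) ×-dec (occursAt? u w z ×-dec (z + len⁺ u ≤? y))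

  occCount-split-at-start : ∀ x s y → x < s → (∀ t → x < t → t < s → ¬ OccursAt u w t) →
    occCount u w x y ≡ count (startsAt? s y) (length w) + occCount u w s y
  occCount-split-at-start x s y x<s none rewrite occCount≡count x y | occCount≡count s y =
    count-union (occBetween? u w x y) (startsAt? s y) (occBetween? u w s y) (length w) split
      (λ { z (refl , o , le) → x<s , le , o }) (λ z (s<z , le , o) → <-trans x<s s<z , le , o)
      (λ { z (refl , _) (s<z , _) → <-irrefl refl s<z })
    where
    split : ∀ z → OccBetween u w x y z → StartsAt s y z ⊎ OccBetween u w s y z
    split z (x<z , le , o) with <-cmp z s
    ... | tri< z<s _ _ = ⊥-elim (none z x<z z<s o)
    ... | tri≈ _ z≡s _ = inj₁ (z≡s , o , le)
    ... | tri> _ _ s<z = inj₂ (s<z , le , o)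

  count-startsAt-one : ∀ s y → s < length w → OccursAt u w s → s + len⁺ u ≤ y →
    count (startsAt? s y) (length w) ≡ 1
  count-startsAt-one s y s<|w| o le = count-single (startsAt? s y) (length w) s s<|w| (refl , o , le) (λ z p → proj₁ p)

  count-startsAt-zero : ∀ s y → ¬ (OccursAt u w s × (s + len⁺ u ≤ y)) → count (startsAt? s y) (length w) ≡ 0
  count-startsAt-zero s y ¬p = count-zero (startsAt? s y) (length w) (λ { z _ (refl , p) → ¬p p })

  EndsAt : ℕ → ℕ → ℕ → Set
  EndsAt y s z = (z + len⁺ u ≡ suc s) × ((y < z) × OccursAt u w z)

  endsAt? : ∀ y s z → Dec (EndsAt y s z)
  endsAt? y s z = (z + len⁺ u ≟ suc s) ×-dec ((y <? z) ×-dec occursAt? u w z)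

  occCount-split-at-end : ∀ y s x → s < x →
    (∀ t → OccursAt u w t → suc (suc s) ≤ t + len⁺ u → t + len⁺ u ≤ x → ⊥) →
    occCount u w y x ≡ count (endsAt? y s) (length w) + occCount u w y s
  occCount-split-at-end y s x s<x none rewrite occCount≡count y x | occCount≡count y s =
    count-union (occBetween? u w y x) (endsAt? y s) (occBetween? u w y s) (length w) split
      (λ z (e , y<z , o) → y<z , subst (_≤ x) (sym e) s<x , o) (λ z (y<z , le , o) → y<z , ≤-trans le (<⇒≤ s<x) , o)
      (λ z (e , _) (_ , le , _) → <-irrefl refl (subst (_≤ s) e le))
    where
    split : ∀ z → OccBetween u w y x z → EndsAt y s z ⊎ OccBetween u w y s z
    split z (y<z , le , o) with <-cmp (z + len⁺ u) (suc s)
    ... | tri< l _ _ = inj₂ (y<z , ≤-pred l , o)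
    ... | tri≈ _ e _ = inj₁ (e , y<z , o)
    ... | tri> _ _ g = ⊥-elim (none z o g le)

  count-endsAt-one : ∀ y s t → EndsAt y s t → count (endsAt? y s) (length w) ≡ 1
  count-endsAt-one y s t p@(_ , _ , o) = count-single (endsAt? y s) (length w) t (OccursAt⇒< u w t o) p
    (λ z q → +-cancelʳ-≡ (len⁺ u) z t (trans (proj₁ q) (sym (proj₁ p))))

  count-endsAt-zero : ∀ y s → (∀ t → ¬ EndsAt y s t) → count (endsAt? y s) (length w) ≡ 0
  count-endsAt-zero y s ¬p = count-zero (endsAt? y s) (length w) (λ z _ p → ¬p z p)

-- Capped occurrence counts of finitely many factors

lookup≤sum : ∀ {n} (v : Vec ℕ n) i → lookup v i ≤ sum v
lookup≤sum (x ∷ v) Fin.zero = m≤m+n x _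
lookup≤sum (x ∷ v) (Fin.suc i) = ≤-trans (lookup≤sum v i) (m≤n+m _ x)

sum-mono-≤ : ∀ {n} (u v : Vec ℕ n) → (∀ i → lookup u i ≤ lookup v i) → sum u ≤ sum v
sum-mono-≤ [] [] le = z≤n
sum-mono-≤ (x ∷ u) (y ∷ v) le = +-mono-≤ (le Fin.zero) (sum-mono-≤ u v (λ i → le (Fin.suc i)))

sum-mono-< : ∀ {n} (u v : Vec ℕ n) → (∀ i → lookup u i ≤ lookup v i) → ∀ j → lookup u j < lookup v j →
  sum u < sum v
sum-mono-< (x ∷ u) (y ∷ v) le Fin.zero lt = +-mono-<-≤ lt (sum-mono-≤ u v (λ i → le (Fin.suc i)))
sum-mono-< (x ∷ u) (y ∷ v) le (Fin.suc j) lt = +-mono-≤-< (le Fin.zero) (sum-mono-< u v (λ i → le (Fin.suc i)) j lt)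

⊓-+-⊓ : ∀ a b D → (a ⊓ D + b ⊓ D) ⊓ D ≡ (a + b) ⊓ D
⊓-+-⊓ a b D with ≤-total a D | ≤-total b D
... | inj₂ D≤a | _ rewrite m≥n⇒m⊓n≡n D≤a =
  trans (m≥n⇒m⊓n≡n (m≤m+n D _)) (sym (m≥n⇒m⊓n≡n (≤-trans D≤a (m≤m+n a b))))
... | inj₁ a≤D | inj₂ D≤b rewrite m≥n⇒m⊓n≡n D≤b =
  trans (m≥n⇒m⊓n≡n (m≤n+m D _)) (sym (m≥n⇒m⊓n≡n (≤-trans D≤b (m≤n+m b a))))
... | inj₁ a≤D | inj₁ b≤D rewrite m≤n⇒m⊓n≡m a≤D | m≤n⇒m⊓n≡m b≤D = refl

∸-split : ∀ x s y → x ≤ s → s ≤ y → y ∸ x ≡ (s ∸ x) + (y ∸ s)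
∸-split x s y x≤s s≤y = +-cancelˡ-≡ x _ _ (begin
  x + (y ∸ x)             ≡⟨ m+[n∸m]≡n (≤-trans x≤s s≤y) ⟩
  y                       ≡⟨ m+[n∸m]≡n s≤y ⟨
  s + (y ∸ s)             ≡⟨ cong (_+ (y ∸ s)) (m+[n∸m]≡n x≤s) ⟨
  x + (s ∸ x) + (y ∸ s)   ≡⟨ +-assoc x (s ∸ x) (y ∸ s) ⟩
  x + ((s ∸ x) + (y ∸ s)) ∎)
  where open ≡-Reasoning

cappedDistance-split : ∀ D x s y → x ≤ s → s ≤ y → ((s ∸ x) ⊓ D + (y ∸ s) ⊓ D) ⊓ D ≡ (y ∸ x) ⊓ D
cappedDistance-split D x s y x≤s s≤y =
  trans (⊓-+-⊓ (s ∸ x) (y ∸ s) D) (cong (_⊓ D) (sym (∸-split x s y x≤s s≤y)))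

⊓-cap-suc : ∀ c n → ((c ⊓ n) + 1) ⊓ suc n ≡ suc c ⊓ suc n
⊓-cap-suc c n rewrite +-comm (c ⊓ n) 1 = cong suc (trans (⊓-assoc c n n) (cong (c ⊓_) (⊓-idem n)))

⊓-cap-idem : ∀ c n → ((c ⊓ n) + 0) ⊓ n ≡ c ⊓ n
⊓-cap-idem c n rewrite +-identityʳ (c ⊓ n) = trans (⊓-assoc c n n) (cong (c ⊓_) (⊓-idem n))

fits⇔ : ∀ s y l D → s ≤ y → l ≤ D → (l ≤ (y ∸ s) ⊓ D) ⇔ (s + l ≤ y)
fits⇔ s y l D s≤y l≤D = mk⇔
  (λ le → subst (_≤ y) (+-comm l s) (m≤o∸n⇒m+n≤o l s≤y (≤-trans le (m⊓n≤m _ _))))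
  (λ le → ⊓-glb (m+n≤o⇒m≤o∸n l (subst (_≤ y) (+-comm s l) le)) l≤D)

occursBeforeF : ∀ {k} → ℕ → List⁺ (Fin k) → FOBet k
occursBeforeF zero u = occursAtF vy u
occursBeforeF (suc e) u = ∃' vx ((vx ≺ vy) ∧' (distanceIs e vx vy ∧' occursAtF vx u))

module _ {k : ℕ} (w : Word k) where

  open Assignments w

  SatBet-occursBeforeF : ∀ ρ h u →
    SatBet w ρ (occursBeforeF h u) ⇔ Σ ℕ (λ t → (t + h ≡ toℕ (ρ vy)) × OccursAt u w t)
  SatBet-occursBeforeF ρ zero u = mk⇔ (λ s → toℕ (ρ vy) , +-identityʳ _ , to (SatBet-occursAtF w ρ vy u) s)
    (λ (t , e , o) → from (SatBet-occursAtF w ρ vy u) (subst (OccursAt u w) (trans (sym (+-identityʳ t)) e) o))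
  SatBet-occursBeforeF ρ (suc e) u = mk⇔ position formula
    where
    y = toℕ (ρ vy)
    position : _ → _
    position (i , i<y , dist , o) =
      toℕ i , trans (+-comm (toℕ i) (suc e)) (trans (cong (_+ toℕ i) (sym y∸i)) (m∸n+n≡m (<⇒≤ i<y))) ,
      to (SatBet-occursAtF w (ρ [ vx ↦ i ]) vx u) o
      where y∸i = to (SatBet-distanceIs w (ρ [ vx ↦ i ]) e vx vy) dist
    formula : _ → _
    formula (t , t+e+1≡y , o) =
      i , i<y , from (SatBet-distanceIs w (ρ [ vx ↦ i ]) e vx vy) y∸i , from (SatBet-occursAtF w (ρ [ vx ↦ i ]) vx u) o′
      where
      t<y : t < y
      t<y = subst (t <_) t+e+1≡y (m<m+n t (s≤s z≤n))
      i = fromℕ< (<-trans t<y (toℕ<n (ρ vy)))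
      i≡t : toℕ i ≡ t
      i≡t = toℕ-fromℕ< _
      i<y : toℕ i < y
      i<y = subst (_< y) (sym i≡t) t<y
      y∸i : y ∸ toℕ i ≡ suc e
      y∸i = trans (cong₂ _∸_ (sym t+e+1≡y) i≡t) (m+n∸m≡n t (suc e))
      o′ : OccursAt u w (toℕ i)
      o′ = subst (OccursAt u w) (sym i≡t) o

module CappedCounts {k : ℕ} (J : ℕ) (U : Fin J → List⁺ (Fin k)) (D : ℕ) where

  Counts : Set
  Counts = Vec ℕ J

  -- A body Ψ c d is a formula about the position vy, given capped counts c and capped distance d.
  Body : Set
  Body = Counts → ℕ → FOBet k

  noCounts : Counts
  noCounts = tabulate (λ _ → 0)

  cap : Counts → Counts → Counts
  cap N c = tabulate (λ j → lookup c j ⊓ lookup N j)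

  countsBetween : Word k → ℕ → ℕ → Counts
  countsBetween w x y = tabulate (λ j → occCount (U j) w x y)

  Consumes : Vec Bool J → Counts → Set
  Consumes π N = Σ (Fin J) λ j → (lookup π j ≡ true) × (1 ≤ lookup N j)

  consumes? : ∀ π N → Dec (Consumes π N)
  consumes? π N = any? (λ j → (lookup π j Bool.≟ true) ×-dec (1 ≤? lookup N j))

  consume : Vec Bool J → Counts → Counts
  consume π N = tabulate (λ j → if lookup π j then pred (lookup N j) else lookup N j)

  consume-< : ∀ π N → Consumes π N → sum (consume π N) < sum N
  consume-< π N (j , πj , 1≤Nj) = sum-mono-< (consume π N) N consume-≤ j consume-<ʲ
    where
    consume-≤ : ∀ i → lookup (consume π N) i ≤ lookup N i
    consume-≤ i rewrite lookup∘tabulate (λ j → if lookup π j then pred (lookup N j) else lookup N j) i with lookup π i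
    ... | true = pred[n]≤n
    ... | false = ≤-refl
    consume-<ʲ : lookup (consume π N) j < lookup N j
    consume-<ʲ rewrite lookup∘tabulate (λ j → if lookup π j then pred (lookup N j) else lookup N j) j | πj =
      subst (_≤ lookup N j) (sym (suc-pred (lookup N j) {{>-nonZero 1≤Nj}})) ≤-refl

  fits : Vec Bool J → ℕ → Fin J → ℕ
  fits π d j = if lookup π j then indicator (len⁺ (U j) ≤? d) else 0

  -- The body seen from a new origin s, at capped distance e from the old one, after the
  -- factors π occurring at s have been accounted for.
  shiftBody : Counts → Body → ℕ → Vec Bool J → Body
  shiftBody N Ψ e π c d = Ψ (tabulate (λ j → (lookup c j + fits π d j) ⊓ lookup N j)) ((e + d) ⊓ D)

  OnlyY : Word k → Body → Set
  OnlyY w Ψ = ∀ c d (ρ ρ' : Assign w) → ρ vy ≡ ρ' vy → SatBet w ρ (Ψ c d) → SatBet w ρ' (Ψ c d)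

  cap-noCounts : ∀ w N x y → (∀ j → 1 ≤ lookup N j → occCount (U j) w x y ≡ 0) →
    cap N (countsBetween w x y) ≡ noCounts
  cap-noCounts w N x y none = tabulate-cong capped
    where
    capped : ∀ j → lookup (countsBetween w x y) j ⊓ lookup N j ≡ 0
    capped j rewrite lookup∘tabulate (λ j → occCount (U j) w x y) j with lookup N j | none j
    ... | zero | _ = ⊓-zeroʳ _
    ... | suc n | none-j rewrite none-j (s≤s z≤n) = refl

  -- Factor j is live while its cap lookup N j is positive.
  noLiveBetween : Counts → Var → Var → FOBet k
  noLiveBetween N a b = AndFin J (λ j → whenPositive (lookup N j) (¬' bin (U j) a b))

  module _ (w : Word k) (ρ : Assign w) where

    SatBet-noLiveBetween : ∀ N a b → toℕ (ρ b) ≤ length w → SatBet w ρ (noLiveBetween N a b) ⇔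
      (∀ j → 1 ≤ lookup N j → occCount (U j) w (toℕ (ρ a)) (toℕ (ρ b)) ≡ 0)
    SatBet-noLiveBetween N a b b≤|w| = mk⇔
      (λ s j live → ¬betfac⇒occCount≡0 (U j) w _ _ (to (Sat-whenPositive betfacI w ρ _ _) (to all s j) live))
      (λ h → from all (λ j → from (Sat-whenPositive betfacI w ρ _ _)
        (λ live occ → <-irrefl refl (subst (0 <_) (h j live) (betfac⇒occCount-pos (U j) w _ _ b≤|w| occ)))))
      where all = Sat-AndFin betfacI w ρ J _

-- Existential quantification to the right over capped counts

noStraddleF : ∀ {k} → List⁺ (Fin k) → FOBet k
noStraddleF u = AndFin (len⁺ u ∸ 1) (λ f → ¬' (gapAtLeast (suc (toℕ f)) vx vy ∧' occursBeforeF (suc (toℕ f)) u))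

inside-offset : ∀ t s l → t < s → s < t + l → Σ ℕ λ f → (f < l ∸ 1) × (t + suc f ≡ s)
inside-offset t s l t<s s<t+l = pred (s ∸ t) , f<l∸1 , t+f+1≡s
  where
  1+f≡ : suc (pred (s ∸ t)) ≡ s ∸ t
  1+f≡ = suc-pred (s ∸ t) {{>-nonZero (m<n⇒0<n∸m t<s)}}
  t+f+1≡s : t + suc (pred (s ∸ t)) ≡ s
  t+f+1≡s = trans (cong (t +_) 1+f≡) (m+[n∸m]≡n (<⇒≤ t<s))
  f<l∸1 : pred (s ∸ t) < l ∸ 1
  f<l∸1 = ∸-monoˡ-≤ 1 (+-cancelˡ-< t (suc (pred (s ∸ t))) l (subst (_< t + l) (sym t+f+1≡s) s<t+l))

module _ {k : ℕ} (w : Word k) (ρ : Assign w) where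

  SatBet-noStartF : ∀ u → toℕ (ρ vx) < toℕ (ρ vy) → SatBet w ρ ((¬' bin u vx vy) ∧' noStraddleF u) ⇔
    (∀ t → toℕ (ρ vx) < t → t < toℕ (ρ vy) → ¬ OccursAt u w t)
  SatBet-noStartF u x<s = mk⇔ noStart formula
    where
    x = toℕ (ρ vx)
    s = toℕ (ρ vy)
    straddles = Sat-AndFin betfacI w ρ (len⁺ u ∸ 1) _
    noStart : _ → _
    noStart (¬occ , ¬straddle) t x<t t<s o with t + len⁺ u ≤? s
    ... | yes t+|u|≤s = ¬occ (t , x<t , t+|u|≤s , o)
    ... | no t+|u|≰s with inside-offset t s (len⁺ u) t<s (≰⇒> t+|u|≰s)
    ... | f , f<|u|∸1 , t+f+1≡s = to straddles ¬straddle (fromℕ< f<|u|∸1)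
            (from (SatBet-gapAtLeast w ρ _ vx vy) (subst (λ q → x + suc q < s) (sym f≡) gap) ,
             from (SatBet-occursBeforeF w ρ _ u) (t , subst (λ q → t + suc q ≡ s) (sym f≡) t+f+1≡s , o))
      where
      f≡ = toℕ-fromℕ< f<|u|∸1
      gap : x + suc f < s
      gap = subst (x + suc f <_) t+f+1≡s (+-monoˡ-< (suc f) x<t)
    formula : _ → _
    formula none =
      (λ (z , x<z , z+|u|≤s , o) → none z x<z (<-≤-trans (m<m+n z (1≤len⁺ u)) z+|u|≤s) o) ,
      from straddles (λ f (gap , before) →
        let (t , t+f+1≡s , o) = to (SatBet-occursBeforeF w ρ (suc (toℕ f)) u) before
            x+f+1<s = to (SatBet-gapAtLeast w ρ (suc (toℕ f)) vx vy) gap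
        in none t (+-cancelʳ-< _ x t (subst (x + suc (toℕ f) <_) (sym t+f+1≡s) x+f+1<s))
                  (subst (t <_) t+f+1≡s (m<m+n t (s≤s z≤n))) o)

module _ {k : ℕ} (u : List⁺ (Fin k)) (w : Word k) (D : ℕ) (|u|≤D : len⁺ u ≤ D) where

  -- One step of the right scan: moving the origin from x to the next start s of an occurrence.
  cappedCount-startStep : ∀ x s y n → x < s → s < y → y ≤ length w →
    (1 ≤ n → ∀ t → x < t → t < s → ¬ OccursAt u w t) →
    let here = does (occursAt? u w s) in
    ((occCount u w s y ⊓ (if here then pred n else n)) + (if here then indicator (len⁺ u ≤? (y ∸ s) ⊓ D) else 0)) ⊓ n
      ≡ occCount u w x y ⊓ n
  cappedCount-startStep x s y zero x<s s<y y≤|w| none = trans (⊓-zeroʳ _) (sym (⊓-zeroʳ _))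
  cappedCount-startStep x s y (suc n) x<s s<y y≤|w| none
    rewrite occCount-split-at-start u w x s y x<s (none (s≤s z≤n)) with occursAt? u w s
  ... | no ¬o rewrite count-startsAt-zero u w s y (λ p → ¬o (proj₁ p)) = ⊓-cap-idem _ (suc n)
  ... | yes o with len⁺ u ≤? (y ∸ s) ⊓ D
  ... | yes fits rewrite count-startsAt-one u w s y (<-≤-trans s<y y≤|w|) o (to (fits⇔ s y _ D (<⇒≤ s<y) |u|≤D) fits) =
    ⊓-cap-suc _ n
  ... | no ¬fits rewrite count-startsAt-zero u w s y (λ p → ¬fits (from (fits⇔ s y _ D (<⇒≤ s<y) |u|≤D) (proj₂ p)))
                       | occCount-short u w s y (<⇒≤ (≰⇒> (λ le → ¬fits (from (fits⇔ s y _ D (<⇒≤ s<y) |u|≤D) le)))) = refl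

module Rightward {k : ℕ} (J : ℕ) (U : Fin J → List⁺ (Fin k)) (D : ℕ) where

  open CappedCounts J U D

  noLiveStartF : Counts → FOBet k
  noLiveStartF N = AndFin J (λ j → whenPositive (lookup N j) ((¬' bin (U j) vx vy) ∧' noStraddleF (U j)))

  patternF : Vec Bool J → FOBet k
  patternF π = AndFin J (λ j → literal (lookup π j) (occursAtF vy (U j)))

  noneLiveF : Counts → Body → FOBet k
  noneLiveF N Ψ = ∃' vy ((vx ≺ vy) ∧' (noLiveBetween N vx vy ∧' withCappedDistance D vx vy (Ψ noCounts)))

  stepF continueF : (Counts → Body → FOBet k) → Counts → Body → ℕ → Vec Bool J → FOBet k
  stepF rec N Ψ e π = patternF π ∧' ∃' vx ((vx ≐ vy) ∧' rec (consume π N) (shiftBody N Ψ e π))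
  continueF rec N Ψ e π = if does (consumes? π N) then stepF rec N Ψ e π else ⊥F

  branchF : (Counts → Body → FOBet k) → Counts → Body → ℕ → FOBet k
  branchF rec N Ψ e = OrBools J (continueF rec N Ψ e)

  firstLiveF : (Counts → Body → FOBet k) → Counts → Body → FOBet k
  firstLiveF rec N Ψ = ∃' vy ((vx ≺ vy) ∧' (noLiveStartF N ∧' withCappedDistance D vx vy (branchF rec N Ψ)))

  -- The fuel bounds the number of live occurrences still to be met, i.e. the sum of the caps.
  existsRightF : ℕ → Counts → Body → FOBet k
  existsRightF zero N Ψ = noneLiveF N Ψ
  existsRightF (suc M) N Ψ = noneLiveF N Ψ ∨F firstLiveF (existsRightF M) N Ψ

  module _ (w : Word k) (|U|≤D : ∀ j → len⁺ (U j) ≤ D) (1≤D : 1 ≤ D) where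

    open Assignments w

    NoLiveStart : Counts → ℕ → ℕ → Set
    NoLiveStart N x s = ∀ j → 1 ≤ lookup N j → ∀ t → x < t → t < s → ¬ OccursAt (U j) w t

    SatBet-noLiveStartF : ∀ ρ N → toℕ (ρ vx) < toℕ (ρ vy) →
      SatBet w ρ (noLiveStartF N) ⇔ NoLiveStart N (toℕ (ρ vx)) (toℕ (ρ vy))
    SatBet-noLiveStartF ρ N x<s = ⇔.trans (Sat-AndFin betfacI w ρ J _) (mk⇔
      (λ h j live → to (SatBet-noStartF w ρ (U j) x<s) (to (Sat-whenPositive betfacI w ρ _ _) (h j) live))
      (λ h j → from (Sat-whenPositive betfacI w ρ _ _) (λ live → from (SatBet-noStartF w ρ (U j) x<s) (h j live))))

    patternAt : ℕ → Vec Bool J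
    patternAt s = tabulate (λ j → does (occursAt? (U j) w s))

    SatBet-patternAt : ∀ ρ → SatBet w ρ (patternF (patternAt (toℕ (ρ vy))))
    SatBet-patternAt ρ = from (Sat-AndFin betfacI w ρ J _) (λ j →
      subst (λ b → SatBet w ρ (literal b (occursAtF vy (U j))))
        (sym (lookup∘tabulate (λ j → does (occursAt? (U j) w (toℕ (ρ vy)))) j))
        (Sat-literal betfacI w ρ (occursAtF vy (U j)) (occursAt? (U j) w (toℕ (ρ vy))) (SatBet-occursAtF w ρ vy (U j))))

    patternF⇒patternAt : ∀ ρ π → SatBet w ρ (patternF π) → π ≡ patternAt (toℕ (ρ vy))
    patternF⇒patternAt ρ π s = trans (sym (tabulate∘lookup π)) (tabulate-cong (λ j →
      literal-does betfacI w ρ (occursAtF vy (U j)) (occursAt? (U j) w (toℕ (ρ vy))) (SatBet-occursAtF w ρ vy (U j))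
        (lookup π j)
        (to (Sat-AndFin betfacI w ρ J _) s j)))

    shiftBody-startStep : ∀ N Ψ x s y → x < s → s < y → y ≤ length w → NoLiveStart N x s →
      shiftBody N Ψ ((s ∸ x) ⊓ D) (patternAt s) (cap (consume (patternAt s) N) (countsBetween w s y)) ((y ∸ s) ⊓ D)
        ≡ Ψ (cap N (countsBetween w x y)) ((y ∸ x) ⊓ D)
    shiftBody-startStep N Ψ x s y x<s s<y y≤|w| none =
      cong₂ Ψ (tabulate-cong step) (cappedDistance-split D x s y (<⇒≤ x<s) (<⇒≤ s<y))
      where
      step : ∀ j → (lookup (cap (consume (patternAt s) N) (countsBetween w s y)) j + fits (patternAt s) ((y ∸ s) ⊓ D) j)
                     ⊓ lookup N j ≡ lookup (countsBetween w x y) j ⊓ lookup N j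
      step j rewrite lookup∘tabulate (λ j → lookup (countsBetween w s y) j ⊓ lookup (consume (patternAt s) N) j) j
                   | lookup∘tabulate (λ j → occCount (U j) w s y) j
                   | lookup∘tabulate (λ j → if lookup (patternAt s) j then pred (lookup N j) else lookup N j) j
                   | lookup∘tabulate (λ j → does (occursAt? (U j) w s)) j
                   | lookup∘tabulate (λ j → occCount (U j) w x y) j
        = cappedCount-startStep (U j) w D (|U|≤D j) x s y (lookup N j) x<s s<y y≤|w| (none j)

    BodyAt : Counts → Body → Assign w → Fin (length w) → Set
    BodyAt N Ψ ρ y =
      SatBet w (ρ [ vy ↦ y ]) (Ψ (cap N (countsBetween w (toℕ (ρ vx)) (toℕ y))) ((toℕ y ∸ toℕ (ρ vx)) ⊓ D))

    ExistsRight : Counts → Body → Assign w → Set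
    ExistsRight N Ψ ρ = Σ (Fin (length w)) λ y → (toℕ (ρ vx) < toℕ y) × BodyAt N Ψ ρ y

    existsRightF-suc : ∀ M N Ψ ρ → SatBet w ρ (existsRightF (suc M) N Ψ) ⇔
      (SatBet w ρ (noneLiveF N Ψ) ⊎ SatBet w ρ (firstLiveF (existsRightF M) N Ψ))
    existsRightF-suc M N Ψ ρ = SatBet-∨ w ρ (noneLiveF N Ψ) (firstLiveF (existsRightF M) N Ψ)

    noneLiveF⇔ : ∀ N (Ψ : Body) ρ (y : Fin (length w)) → toℕ (ρ vx) < toℕ y →
      (∀ j → 1 ≤ lookup N j → occCount (U j) w (toℕ (ρ vx)) (toℕ y) ≡ 0) →
      SatBet w (ρ [ vy ↦ y ]) (noLiveBetween N vx vy ∧' withCappedDistance D vx vy (Ψ noCounts)) ⇔ BodyAt N Ψ ρ y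
    noneLiveF⇔ N Ψ ρ y x<y none rewrite cap-noCounts w N _ _ none = mk⇔
      (λ (_ , s) → to (SatBet-withCappedDistance w (ρ [ vy ↦ y ]) D vx vy (Ψ noCounts) 1≤D x<y) s)
      (λ s → from (SatBet-noLiveBetween w (ρ [ vy ↦ y ]) N vx vy (<⇒≤ (toℕ<n y))) none ,
             from (SatBet-withCappedDistance w (ρ [ vy ↦ y ]) D vx vy (Ψ noCounts) 1≤D x<y) s)

    noneLiveF⇒ : ∀ N Ψ ρ → SatBet w ρ (noneLiveF N Ψ) → ExistsRight N Ψ ρ
    noneLiveF⇒ N Ψ ρ (y , x<y , s@(none , _)) =
      y , x<y , to (noneLiveF⇔ N Ψ ρ y x<y
        (to (SatBet-noLiveBetween w (ρ [ vy ↦ y ]) N vx vy (<⇒≤ (toℕ<n y))) none)) s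

    ⇒noneLiveF : ∀ N Ψ ρ (y : Fin (length w)) → toℕ (ρ vx) < toℕ y →
      (∀ j → 1 ≤ lookup N j → occCount (U j) w (toℕ (ρ vx)) (toℕ y) ≡ 0) →
      BodyAt N Ψ ρ y → SatBet w ρ (noneLiveF N Ψ)
    ⇒noneLiveF N Ψ ρ y x<y none body = y , x<y , from (noneLiveF⇔ N Ψ ρ y x<y none) body

    Sound Complete : ℕ → Set
    Sound M = ∀ N Ψ → OnlyY w Ψ → sum N ≤ M → ∀ ρ → SatBet w ρ (existsRightF M N Ψ) → ExistsRight N Ψ ρ
    Complete M = ∀ N Ψ → OnlyY w Ψ → sum N ≤ M → ∀ ρ → ExistsRight N Ψ ρ → SatBet w ρ (existsRightF M N Ψ)

    firstLiveF⇒ : ∀ M → Sound M →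
      ∀ N Ψ → OnlyY w Ψ → sum N ≤ suc M →
      ∀ ρ → SatBet w ρ (firstLiveF (existsRightF M) N Ψ) → ExistsRight N Ψ ρ
    firstLiveF⇒ M IH N Ψ onlyY ≤M ρ (sF , x<s , noStart , cont) = continue π c
      where
      ρs = ρ [ vy ↦ sF ]
      x = toℕ (ρ vx)
      s = toℕ sF
      e = (s ∸ x) ⊓ D
      πc = to (SatBet-OrBools w ρs J (continueF (existsRightF M) N Ψ e))
              (to (SatBet-withCappedDistance w ρs D vx vy (branchF (existsRightF M) N Ψ) 1≤D x<s) cont)
      π = proj₁ πc
      c = proj₂ πc
      recurse : ∀ π → π ≡ patternAt s → ∀ i → i ≡ sF →
        SatBet w (ρs [ vx ↦ i ]) (existsRightF M (consume π N) (shiftBody N Ψ e π)) →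
        sum (consume π N) < sum N → ExistsRight N Ψ ρ
      recurse π refl i refl rest dec
        with IH (consume π N) (shiftBody N Ψ e π) (λ c d → onlyY _ _) (≤-pred (≤-trans dec ≤M)) _ rest
      ... | y , s<y , body = y , <-trans x<s s<y , onlyY _ _ _ (ρ [ vy ↦ y ]) refl
              (subst (SatBet w _) (shiftBody-startStep N Ψ x s (toℕ y) x<s s<y (<⇒≤ (toℕ<n y))
                (to (SatBet-noLiveStartF ρs N x<s) noStart)) body)
      continue : ∀ π → SatBet w ρs (continueF (existsRightF M) N Ψ e π) → ExistsRight N Ψ ρ
      continue π c with to (Sat-if betfacI w ρs (consumes? π N) (stepF (existsRightF M) N Ψ e π)) c
      ... | consumes , pat , i , i≡s , rest =
        recurse π (patternF⇒patternAt ρs π pat) i i≡s rest (consume-< π N consumes)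

    ⇒firstLiveF : ∀ M → Complete M →
      ∀ N Ψ → OnlyY w Ψ → sum N ≤ suc M → ∀ ρ (y sF : Fin (length w)) →
      toℕ (ρ vx) < toℕ sF → toℕ sF < toℕ y → NoLiveStart N (toℕ (ρ vx)) (toℕ sF) →
      (Σ (Fin J) λ j → (1 ≤ lookup N j) × OccursAt (U j) w (toℕ sF)) →
      BodyAt N Ψ ρ y → SatBet w ρ (firstLiveF (existsRightF M) N Ψ)
    ⇒firstLiveF M IH N Ψ onlyY ≤M ρ y sF x<s s<y none (j , live , occ) body =
      sF , x<s , from (SatBet-noLiveStartF ρs N x<s) none ,
      from (SatBet-withCappedDistance w ρs D vx vy (branchF (existsRightF M) N Ψ) 1≤D x<s)
        (from (SatBet-OrBools w ρs J (continueF (existsRightF M) N Ψ e))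
          (π , from (Sat-if betfacI w ρs (consumes? π N) (stepF (existsRightF M) N Ψ e π))
                 (consumes , SatBet-patternAt ρs , sF , refl , rest)))
      where
      ρs = ρ [ vy ↦ sF ]
      x = toℕ (ρ vx)
      s = toℕ sF
      e = (s ∸ x) ⊓ D
      π = patternAt s
      consumes : Consumes π N
      consumes = j , trans (lookup∘tabulate (λ j → does (occursAt? (U j) w s)) j) (dec-true (occursAt? (U j) w s) occ) ,
                 live
      shifted = shiftBody-startStep N Ψ x s (toℕ y) x<s s<y (<⇒≤ (toℕ<n y)) none
      rest : SatBet w (ρs [ vx ↦ sF ]) (existsRightF M (consume π N) (shiftBody N Ψ e π))
      rest = IH (consume π N) (shiftBody N Ψ e π) (λ c d → onlyY _ _)
        (≤-pred (≤-trans (consume-< π N consumes) ≤M)) _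
        (y , s<y , onlyY _ _ (ρ [ vy ↦ y ]) _ refl (subst (SatBet w _) (sym shifted) body))

    noneLiveF⇒existsRightF : ∀ M N Ψ ρ → SatBet w ρ (noneLiveF N Ψ) → SatBet w ρ (existsRightF M N Ψ)
    noneLiveF⇒existsRightF zero N Ψ ρ s = s
    noneLiveF⇒existsRightF (suc M) N Ψ ρ s = from (existsRightF-suc M N Ψ ρ) (inj₁ s)

    existsRightF⇒ : ∀ M → Sound M
    existsRightF⇒ zero N Ψ onlyY ≤M ρ s = noneLiveF⇒ N Ψ ρ s
    existsRightF⇒ (suc M) N Ψ onlyY ≤M ρ s with to (existsRightF-suc M N Ψ ρ) s
    ... | inj₁ s = noneLiveF⇒ N Ψ ρ s
    ... | inj₂ s = firstLiveF⇒ M (existsRightF⇒ M) N Ψ onlyY ≤M ρ s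

    liveStartAfter? : ∀ N x t → Dec ((x < t) × Σ (Fin J) λ j → (1 ≤ lookup N j) × OccursAt (U j) w t)
    liveStartAfter? N x t = (x <? t) ×-dec any? (λ j → (1 ≤? lookup N j) ×-dec occursAt? (U j) w t)

    -- Some live factor occurs between x and y: scan to the first start s of a live occurrence.
    ⇒existsRightF : ∀ M → Complete M
    ⇒existsRightF M N Ψ onlyY ≤M ρ (y , x<y , body)
      with any? (λ j → (1 ≤? lookup N j) ×-dec (1 ≤? occCount (U j) w (toℕ (ρ vx)) (toℕ y)))
    ... | no ¬live = noneLiveF⇒existsRightF M N Ψ ρ
          (⇒noneLiveF N Ψ ρ y x<y (λ j live → n≤0⇒n≡0 (≮⇒≥ (λ pos → ¬live (j , live , pos)))) body)
    ⇒existsRightF zero N Ψ onlyY ≤M ρ (y , x<y , body) | yes (j , live , _) =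
      ⊥-elim (<-irrefl refl (≤-trans (≤-trans live (lookup≤sum N j)) ≤M))
    ⇒existsRightF (suc M) N Ψ onlyY ≤M ρ (y , x<y , body) | yes (j , live , pos)
      with occCount-pos⇒betfac (U j) w _ _ pos
    ... | t , x<t , t+|u|≤y , occ
      with least-witness (liveStartAfter? N (toℕ (ρ vx))) t (x<t , j , live , occ)
    ... | s , s≤t , (x<s , j′ , live′ , occ′) , first =
      from (existsRightF-suc M N Ψ ρ) (inj₂ (⇒firstLiveF M (⇒existsRightF M) N Ψ onlyY ≤M ρ y sF
        (subst (toℕ (ρ vx) <_) (sym s≡) x<s) (subst (_< toℕ y) (sym s≡) s<y)
        (λ j live t x<t t<s occ → first t (subst (t <_) s≡ t<s) (x<t , j , live , occ))
        (j′ , live′ , subst (OccursAt (U j′) w) (sym s≡) occ′) body))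
      where
      s<y : s < toℕ y
      s<y = ≤-<-trans s≤t (<-≤-trans (m<m+n t (1≤len⁺ (U j))) t+|u|≤y)
      sF = fromℕ< (<-trans s<y (toℕ<n y))
      s≡ : toℕ sF ≡ s
      s≡ = toℕ-fromℕ< _

    SatBet-existsRightF : ∀ N Ψ → OnlyY w Ψ → ∀ ρ → SatBet w ρ (existsRightF (sum N) N Ψ) ⇔ ExistsRight N Ψ ρ
    SatBet-existsRightF N Ψ onlyY ρ =
      mk⇔ (existsRightF⇒ _ N Ψ onlyY ≤-refl ρ) (⇒existsRightF _ N Ψ onlyY ≤-refl ρ)

-- Existential quantification to the left over capped counts

noStraddleEndF : ∀ {k} → List⁺ (Fin k) → FOBet k
noStraddleEndF u =
  AndFin (len⁺ u ∸ 1) (λ h → ¬' (gapAtLeast (len⁺ u ∸ 1 ∸ toℕ h) vy vx ∧' occursBeforeF (toℕ h) u))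

end≡ : ∀ t h l → h < l ∸ 1 → suc ((t + h) + (l ∸ 1 ∸ h)) ≡ t + l
end≡ t h (suc l) h<l = begin
  suc (t + h + (l ∸ h))   ≡⟨ cong suc (+-assoc t h (l ∸ h)) ⟩
  suc (t + (h + (l ∸ h))) ≡⟨ cong (λ q → suc (t + q)) (m+[n∸m]≡n (<⇒≤ h<l)) ⟩
  suc (t + l)             ≡⟨ +-suc t l ⟨
  t + suc l               ∎
  where open ≡-Reasoning

OccursEndingAt : ∀ {k} → List⁺ (Fin k) → Word k → ℕ → Set
OccursEndingAt u w s = Σ ℕ λ t → (t + len⁺ u ≡ suc s) × OccursAt u w t

occursEndingAt? : ∀ {k} (u : List⁺ (Fin k)) (w : Word k) s → Dec (OccursEndingAt u w s)
occursEndingAt? u w s with any? {n = suc s} (λ i → (toℕ i + len⁺ u ≟ suc s) ×-dec occursAt? u w (toℕ i))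
... | yes (i , p) = yes (toℕ i , p)
... | no ¬p = no λ (t , e , o) → ¬p (bounded t e o)
  where
  bounded : ∀ t → t + len⁺ u ≡ suc s → OccursAt u w t → _
  bounded t e o =
    fromℕ< t<1+s , subst (λ q → (q + len⁺ u ≡ suc s) × OccursAt u w q) (sym (toℕ-fromℕ< t<1+s)) (e , o)
    where
    t<1+s : t < suc s
    t<1+s = subst (t <_) e (m<m+n t (1≤len⁺ u))

module _ {k : ℕ} (w : Word k) (ρ : Assign w) where

  SatBet-noEndF : ∀ u → toℕ (ρ vy) < toℕ (ρ vx) → SatBet w ρ ((¬' bin u vy vx) ∧' noStraddleEndF u) ⇔
    (∀ t → OccursAt u w t → suc (suc (toℕ (ρ vy))) ≤ t + len⁺ u → t + len⁺ u ≤ toℕ (ρ vx) → ⊥)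
  SatBet-noEndF u s<x = mk⇔ noEnd formula
    where
    s = toℕ (ρ vy)
    x = toℕ (ρ vx)
    l = len⁺ u
    straddles = Sat-AndFin betfacI w ρ (l ∸ 1) _
    noEnd : _ → _
    noEnd (¬occ , ¬straddle) t o s+2≤t+l t+l≤x with s <? t
    ... | yes s<t = ¬occ (t , s<t , t+l≤x , o)
    ... | no s≮t = to straddles ¬straddle (fromℕ< h<l∸1)
            (from (SatBet-gapAtLeast w ρ _ vy vx) (subst (λ q → s + (l ∸ 1 ∸ q) < x) (sym h≡) gap) ,
             from (SatBet-occursBeforeF w ρ _ u) (t , subst (λ q → t + q ≡ s) (sym h≡) t+h≡s , o))
      where
      h = s ∸ t
      t+h≡s : t + h ≡ s
      t+h≡s = m+[n∸m]≡n (≮⇒≥ s≮t)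
      h<l∸1 : h < l ∸ 1
      h<l∸1 = ∸-monoˡ-≤ 1 (+-cancelˡ-≤ t (suc (suc h)) l (subst (_≤ t + l)
        (trans (cong (λ q → suc (suc q)) (sym t+h≡s)) (sym (trans (+-suc t (suc h)) (cong suc (+-suc t h))))) s+2≤t+l))
      h≡ = toℕ-fromℕ< h<l∸1
      gap : s + (l ∸ 1 ∸ h) < x
      gap = subst (_≤ x) (sym (trans (cong (λ q → suc (q + (l ∸ 1 ∸ h))) (sym t+h≡s)) (end≡ t h l h<l∸1))) t+l≤x
    formula : _ → _
    formula none =
      (λ (z , s<z , z+l≤x , o) → none z o (≤-trans (s≤s s<z) (subst (_≤ z + l) (+-comm z 1) (+-monoʳ-≤ z (1≤len⁺ u)))) z+l≤x) ,
      from straddles (λ h (gap , before) →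
        let (t , t+h≡s , o) = to (SatBet-occursBeforeF w ρ (toℕ h) u) before
            t+l≡ = trans (cong (λ q → suc (q + (l ∸ 1 ∸ toℕ h))) (sym t+h≡s)) (end≡ t (toℕ h) l (toℕ<n h))
            1≤rest = m<n⇒0<n∸m (toℕ<n h)
        in none t o (subst (suc (suc s) ≤_) t+l≡ (s≤s (subst (_≤ s + (l ∸ 1 ∸ toℕ h)) (+-comm s 1) (+-monoʳ-≤ s 1≤rest))))
                    (subst (_≤ x) t+l≡ (to (SatBet-gapAtLeast w ρ (l ∸ 1 ∸ toℕ h) vy vx) gap)))

module _ {k : ℕ} (u : List⁺ (Fin k)) (w : Word k) (D : ℕ) (|u|≤D : len⁺ u ≤ D) where

  -- One step of the left scan: moving the origin from x to the previous end s of an occurrence.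
  cappedCount-endStep : ∀ y s x n → y < s → s < x →
    (1 ≤ n → ∀ t → OccursAt u w t → suc (suc s) ≤ t + len⁺ u → t + len⁺ u ≤ x → ⊥) →
    let here = does (occursEndingAt? u w s) in
    ((occCount u w y s ⊓ (if here then pred n else n)) + (if here then indicator (len⁺ u ≤? (s ∸ y) ⊓ D) else 0)) ⊓ n
      ≡ occCount u w y x ⊓ n
  cappedCount-endStep y s x zero y<s s<x none = trans (⊓-zeroʳ _) (sym (⊓-zeroʳ _))
  cappedCount-endStep y s x (suc n) y<s s<x none
    rewrite occCount-split-at-end u w y s x s<x (none (s≤s z≤n)) with occursEndingAt? u w s
  ... | no ¬e rewrite count-endsAt-zero u w y s (λ t (e , _ , o) → ¬e (t , e , o)) = ⊓-cap-idem _ (suc n)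
  ... | yes (t , e , o) with len⁺ u ≤? (s ∸ y) ⊓ D
  ... | yes fits
    rewrite count-endsAt-one u w y s t (e , +-cancelʳ-< (len⁺ u) y t
              (subst (y + len⁺ u <_) (sym e) (s≤s (to (fits⇔ y s _ D (<⇒≤ y<s) |u|≤D) fits))) , o) = ⊓-cap-suc _ n
  ... | no ¬fits rewrite count-endsAt-zero u w y s (λ z (e′ , y<z , _) →
                           ¬fits (from (fits⇔ y s _ D (<⇒≤ y<s) |u|≤D) (≤-pred (subst (y + len⁺ u <_) e′ (+-monoˡ-< (len⁺ u) y<z)))))
                       | occCount-short u w y s (<⇒≤ (≰⇒> (λ le → ¬fits (from (fits⇔ y s _ D (<⇒≤ y<s) |u|≤D) le)))) = refl

end≡pred : ∀ {k} t (u : List⁺ (Fin k)) → t + len⁺ u ≡ suc (pred (t + len⁺ u))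
end≡pred t u = sym (suc-pred (t + len⁺ u) {{>-nonZero (≤-trans (1≤len⁺ u) (m≤n+m _ t))}})

end<x : ∀ {k} t (u : List⁺ (Fin k)) {x} → t + len⁺ u ≤ x → pred (t + len⁺ u) < x
end<x t u {x} = subst (_≤ x) (end≡pred t u)

module Leftward {k : ℕ} (J : ℕ) (U : Fin J → List⁺ (Fin k)) (D : ℕ) where

  open CappedCounts J U D

  noLiveEndF : Counts → FOBet k
  noLiveEndF N = AndFin J (λ j → whenPositive (lookup N j) ((¬' bin (U j) vy vx) ∧' noStraddleEndF (U j)))

  patternF : Vec Bool J → FOBet k
  patternF π = AndFin J (λ j → literal (lookup π j) (occursBeforeF (len⁺ (U j) ∸ 1) (U j)))

  noneLiveF : Counts → Body → FOBet k
  noneLiveF N Ψ = ∃' vy ((vy ≺ vx) ∧' (noLiveBetween N vy vx ∧' withCappedDistance D vy vx (Ψ noCounts)))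

  stepF continueF : (Counts → Body → FOBet k) → Counts → Body → ℕ → Vec Bool J → FOBet k
  stepF rec N Ψ e π = patternF π ∧' ∃' vx ((vx ≐ vy) ∧' rec (consume π N) (shiftBody N Ψ e π))
  continueF rec N Ψ e π = if does (consumes? π N) then stepF rec N Ψ e π else ⊥F

  branchF : (Counts → Body → FOBet k) → Counts → Body → ℕ → FOBet k
  branchF rec N Ψ e = OrBools J (continueF rec N Ψ e)

  firstLiveF : (Counts → Body → FOBet k) → Counts → Body → FOBet k
  firstLiveF rec N Ψ = ∃' vy ((vy ≺ vx) ∧' (noLiveEndF N ∧' withCappedDistance D vy vx (branchF rec N Ψ)))

  existsLeftF : ℕ → Counts → Body → FOBet k
  existsLeftF zero N Ψ = noneLiveF N Ψ
  existsLeftF (suc M) N Ψ = noneLiveF N Ψ ∨F firstLiveF (existsLeftF M) N Ψ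

  module _ (w : Word k) (|U|≤D : ∀ j → len⁺ (U j) ≤ D) (1≤D : 1 ≤ D) where

    open Assignments w

    NoLiveEnd : Counts → ℕ → ℕ → Set
    NoLiveEnd N s x =
      ∀ j → 1 ≤ lookup N j → ∀ t → OccursAt (U j) w t → suc (suc s) ≤ t + len⁺ (U j) → t + len⁺ (U j) ≤ x → ⊥

    SatBet-noLiveEndF : ∀ ρ N → toℕ (ρ vy) < toℕ (ρ vx) →
      SatBet w ρ (noLiveEndF N) ⇔ NoLiveEnd N (toℕ (ρ vy)) (toℕ (ρ vx))
    SatBet-noLiveEndF ρ N s<x = ⇔.trans (Sat-AndFin betfacI w ρ J _) (mk⇔
      (λ h j live → to (SatBet-noEndF w ρ (U j) s<x) (to (Sat-whenPositive betfacI w ρ _ _) (h j) live))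
      (λ h j → from (Sat-whenPositive betfacI w ρ _ _) (λ live → from (SatBet-noEndF w ρ (U j) s<x) (h j live))))

    SatBet-endsAtF : ∀ ρ u → SatBet w ρ (occursBeforeF (len⁺ u ∸ 1) u) ⇔ OccursEndingAt u w (toℕ (ρ vy))
    SatBet-endsAtF ρ u@(_ ∷ as) = ⇔.trans (SatBet-occursBeforeF w ρ (len⁺ u ∸ 1) u) (Σ-⇔ λ t → mk⇔
      (λ (e , o) → trans (+-suc t (length as)) (cong suc e) , o)
      (λ (e , o) → suc-injective (trans (sym (+-suc t (length as))) e) , o))

    patternAt : ℕ → Vec Bool J
    patternAt s = tabulate (λ j → does (occursEndingAt? (U j) w s))

    SatBet-patternAt : ∀ ρ → SatBet w ρ (patternF (patternAt (toℕ (ρ vy))))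
    SatBet-patternAt ρ = from (Sat-AndFin betfacI w ρ J _) (λ j →
      subst (λ b → SatBet w ρ (literal b (occursBeforeF (len⁺ (U j) ∸ 1) (U j))))
        (sym (lookup∘tabulate (λ j → does (occursEndingAt? (U j) w (toℕ (ρ vy)))) j))
        (Sat-literal betfacI w ρ (occursBeforeF (len⁺ (U j) ∸ 1) (U j)) (occursEndingAt? (U j) w (toℕ (ρ vy)))
          (SatBet-endsAtF ρ (U j))))

    patternF⇒patternAt : ∀ ρ π → SatBet w ρ (patternF π) → π ≡ patternAt (toℕ (ρ vy))
    patternF⇒patternAt ρ π s = trans (sym (tabulate∘lookup π)) (tabulate-cong (λ j →
      literal-does betfacI w ρ (occursBeforeF (len⁺ (U j) ∸ 1) (U j)) (occursEndingAt? (U j) w (toℕ (ρ vy)))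
        (SatBet-endsAtF ρ (U j)) (lookup π j) (to (Sat-AndFin betfacI w ρ J _) s j)))

    shiftBody-endStep : ∀ N Ψ y s x → y < s → s < x → NoLiveEnd N s x →
      shiftBody N Ψ ((x ∸ s) ⊓ D) (patternAt s) (cap (consume (patternAt s) N) (countsBetween w y s)) ((s ∸ y) ⊓ D)
        ≡ Ψ (cap N (countsBetween w y x)) ((x ∸ y) ⊓ D)
    shiftBody-endStep N Ψ y s x y<s s<x none = cong₂ Ψ (tabulate-cong step) distance
      where
      distance : ((x ∸ s) ⊓ D + (s ∸ y) ⊓ D) ⊓ D ≡ (x ∸ y) ⊓ D
      distance = trans (cong (_⊓ D) (+-comm ((x ∸ s) ⊓ D) _)) (cappedDistance-split D y s x (<⇒≤ y<s) (<⇒≤ s<x))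
      step : ∀ j → (lookup (cap (consume (patternAt s) N) (countsBetween w y s)) j + fits (patternAt s) ((s ∸ y) ⊓ D) j)
                     ⊓ lookup N j ≡ lookup (countsBetween w y x) j ⊓ lookup N j
      step j rewrite lookup∘tabulate (λ j → lookup (countsBetween w y s) j ⊓ lookup (consume (patternAt s) N) j) j
                   | lookup∘tabulate (λ j → occCount (U j) w y s) j
                   | lookup∘tabulate (λ j → if lookup (patternAt s) j then pred (lookup N j) else lookup N j) j
                   | lookup∘tabulate (λ j → does (occursEndingAt? (U j) w s)) j
                   | lookup∘tabulate (λ j → occCount (U j) w y x) j
        = cappedCount-endStep (U j) w D (|U|≤D j) y s x (lookup N j) y<s s<x (none j)

    BodyAt : Counts → Body → Assign w → Fin (length w) → Set
    BodyAt N Ψ ρ y =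
      SatBet w (ρ [ vy ↦ y ]) (Ψ (cap N (countsBetween w (toℕ y) (toℕ (ρ vx)))) ((toℕ (ρ vx) ∸ toℕ y) ⊓ D))

    ExistsLeft : Counts → Body → Assign w → Set
    ExistsLeft N Ψ ρ = Σ (Fin (length w)) λ y → (toℕ y < toℕ (ρ vx)) × BodyAt N Ψ ρ y

    existsLeftF-suc : ∀ M N Ψ ρ → SatBet w ρ (existsLeftF (suc M) N Ψ) ⇔
      (SatBet w ρ (noneLiveF N Ψ) ⊎ SatBet w ρ (firstLiveF (existsLeftF M) N Ψ))
    existsLeftF-suc M N Ψ ρ = SatBet-∨ w ρ (noneLiveF N Ψ) (firstLiveF (existsLeftF M) N Ψ)

    noneLiveF⇔ : ∀ N (Ψ : Body) ρ (y : Fin (length w)) → toℕ y < toℕ (ρ vx) →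
      (∀ j → 1 ≤ lookup N j → occCount (U j) w (toℕ y) (toℕ (ρ vx)) ≡ 0) →
      SatBet w (ρ [ vy ↦ y ]) (noLiveBetween N vy vx ∧' withCappedDistance D vy vx (Ψ noCounts)) ⇔ BodyAt N Ψ ρ y
    noneLiveF⇔ N Ψ ρ y y<x none rewrite cap-noCounts w N _ _ none = mk⇔
      (λ (_ , s) → to (SatBet-withCappedDistance w (ρ [ vy ↦ y ]) D vy vx (Ψ noCounts) 1≤D y<x) s)
      (λ s → from (SatBet-noLiveBetween w (ρ [ vy ↦ y ]) N vy vx (<⇒≤ (toℕ<n (ρ vx)))) none ,
             from (SatBet-withCappedDistance w (ρ [ vy ↦ y ]) D vy vx (Ψ noCounts) 1≤D y<x) s)

    noneLiveF⇒ : ∀ N Ψ ρ → SatBet w ρ (noneLiveF N Ψ) → ExistsLeft N Ψ ρ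
    noneLiveF⇒ N Ψ ρ (y , y<x , s@(none , _)) =
      y , y<x , to (noneLiveF⇔ N Ψ ρ y y<x
        (to (SatBet-noLiveBetween w (ρ [ vy ↦ y ]) N vy vx (<⇒≤ (toℕ<n (ρ vx)))) none)) s

    ⇒noneLiveF : ∀ N Ψ ρ (y : Fin (length w)) → toℕ y < toℕ (ρ vx) →
      (∀ j → 1 ≤ lookup N j → occCount (U j) w (toℕ y) (toℕ (ρ vx)) ≡ 0) →
      BodyAt N Ψ ρ y → SatBet w ρ (noneLiveF N Ψ)
    ⇒noneLiveF N Ψ ρ y y<x none body = y , y<x , from (noneLiveF⇔ N Ψ ρ y y<x none) body

    Sound Complete : ℕ → Set
    Sound M = ∀ N Ψ → OnlyY w Ψ → sum N ≤ M → ∀ ρ → SatBet w ρ (existsLeftF M N Ψ) → ExistsLeft N Ψ ρ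
    Complete M = ∀ N Ψ → OnlyY w Ψ → sum N ≤ M → ∀ ρ → ExistsLeft N Ψ ρ → SatBet w ρ (existsLeftF M N Ψ)

    firstLiveF⇒ : ∀ M → Sound M →
      ∀ N Ψ → OnlyY w Ψ → sum N ≤ suc M →
      ∀ ρ → SatBet w ρ (firstLiveF (existsLeftF M) N Ψ) → ExistsLeft N Ψ ρ
    firstLiveF⇒ M IH N Ψ onlyY ≤M ρ (sF , s<x , noEnd , cont) = continue π c
      where
      ρs = ρ [ vy ↦ sF ]
      x = toℕ (ρ vx)
      s = toℕ sF
      e = (x ∸ s) ⊓ D
      πc = to (SatBet-OrBools w ρs J (continueF (existsLeftF M) N Ψ e))
              (to (SatBet-withCappedDistance w ρs D vy vx (branchF (existsLeftF M) N Ψ) 1≤D s<x) cont)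
      π = proj₁ πc
      c = proj₂ πc
      recurse : ∀ π → π ≡ patternAt s → ∀ i → i ≡ sF →
        SatBet w (ρs [ vx ↦ i ]) (existsLeftF M (consume π N) (shiftBody N Ψ e π)) →
        sum (consume π N) < sum N → ExistsLeft N Ψ ρ
      recurse π refl i refl rest dec
        with IH (consume π N) (shiftBody N Ψ e π) (λ c d → onlyY _ _) (≤-pred (≤-trans dec ≤M)) _ rest
      ... | y , y<s , body = y , <-trans y<s s<x , onlyY _ _ _ (ρ [ vy ↦ y ]) refl
              (subst (SatBet w _) (shiftBody-endStep N Ψ (toℕ y) s x y<s s<x (to (SatBet-noLiveEndF ρs N s<x) noEnd)) body)
      continue : ∀ π → SatBet w ρs (continueF (existsLeftF M) N Ψ e π) → ExistsLeft N Ψ ρ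
      continue π c
        with to (Sat-if betfacI w ρs (consumes? π N) (stepF (existsLeftF M) N Ψ e π)) c
      ... | consumes , pat , i , i≡s , rest =
        recurse π (patternF⇒patternAt ρs π pat) i i≡s rest (consume-< π N consumes)

    ⇒firstLiveF : ∀ M → Complete M →
      ∀ N Ψ → OnlyY w Ψ → sum N ≤ suc M → ∀ ρ (y sF : Fin (length w)) →
      toℕ y < toℕ sF → toℕ sF < toℕ (ρ vx) → NoLiveEnd N (toℕ sF) (toℕ (ρ vx)) →
      (Σ (Fin J) λ j → (1 ≤ lookup N j) × OccursEndingAt (U j) w (toℕ sF)) →
      BodyAt N Ψ ρ y → SatBet w ρ (firstLiveF (existsLeftF M) N Ψ)
    ⇒firstLiveF M IH N Ψ onlyY ≤M ρ y sF y<s s<x none (j , live , ends) body =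
      sF , s<x , from (SatBet-noLiveEndF ρs N s<x) none ,
      from (SatBet-withCappedDistance w ρs D vy vx (branchF (existsLeftF M) N Ψ) 1≤D s<x)
        (from (SatBet-OrBools w ρs J (continueF (existsLeftF M) N Ψ e))
          (π , from (Sat-if betfacI w ρs (consumes? π N) (stepF (existsLeftF M) N Ψ e π))
                 (consumes , SatBet-patternAt ρs , sF , refl , rest)))
      where
      ρs = ρ [ vy ↦ sF ]
      x = toℕ (ρ vx)
      s = toℕ sF
      e = (x ∸ s) ⊓ D
      π = patternAt s
      consumes : Consumes π N
      consumes = j , trans (lookup∘tabulate (λ j → does (occursEndingAt? (U j) w s)) j)
                             (dec-true (occursEndingAt? (U j) w s) ends) , live
      shifted = shiftBody-endStep N Ψ (toℕ y) s x y<s s<x none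
      rest : SatBet w (ρs [ vx ↦ sF ]) (existsLeftF M (consume π N) (shiftBody N Ψ e π))
      rest = IH (consume π N) (shiftBody N Ψ e π) (λ c d → onlyY _ _)
        (≤-pred (≤-trans (consume-< π N consumes) ≤M)) _
        (y , y<s , onlyY _ _ (ρ [ vy ↦ y ]) _ refl (subst (SatBet w _) (sym shifted) body))

    noneLiveF⇒existsLeftF : ∀ M N Ψ ρ → SatBet w ρ (noneLiveF N Ψ) → SatBet w ρ (existsLeftF M N Ψ)
    noneLiveF⇒existsLeftF zero N Ψ ρ s = s
    noneLiveF⇒existsLeftF (suc M) N Ψ ρ s = from (existsLeftF-suc M N Ψ ρ) (inj₁ s)

    existsLeftF⇒ : ∀ M → Sound M
    existsLeftF⇒ zero N Ψ onlyY ≤M ρ s = noneLiveF⇒ N Ψ ρ s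
    existsLeftF⇒ (suc M) N Ψ onlyY ≤M ρ s with to (existsLeftF-suc M N Ψ ρ) s
    ... | inj₁ s = noneLiveF⇒ N Ψ ρ s
    ... | inj₂ s = firstLiveF⇒ M (existsLeftF⇒ M) N Ψ onlyY ≤M ρ s

    liveEndAt? : ∀ N s → Dec (Σ (Fin J) λ j → (1 ≤ lookup N j) × OccursEndingAt (U j) w s)
    liveEndAt? N s = any? (λ j → (1 ≤? lookup N j) ×-dec occursEndingAt? (U j) w s)

    -- Some live factor occurs between y and x: scan to the last end s of a live occurrence.
    ⇒existsLeftF : ∀ M → Complete M
    ⇒existsLeftF M N Ψ onlyY ≤M ρ (y , y<x , body)
      with any? (λ j → (1 ≤? lookup N j) ×-dec (1 ≤? occCount (U j) w (toℕ y) (toℕ (ρ vx))))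
    ... | no ¬live = noneLiveF⇒existsLeftF M N Ψ ρ
          (⇒noneLiveF N Ψ ρ y y<x (λ j live → n≤0⇒n≡0 (≮⇒≥ (λ pos → ¬live (j , live , pos)))) body)
    ⇒existsLeftF zero N Ψ onlyY ≤M ρ (y , y<x , body) | yes (j , live , _) =
      ⊥-elim (<-irrefl refl (≤-trans (≤-trans live (lookup≤sum N j)) ≤M))
    ⇒existsLeftF (suc M) N Ψ onlyY ≤M ρ (y , y<x , body) | yes (j , live , pos)
      with occCount-pos⇒betfac (U j) w _ _ pos
    ... | t , y<t , t+l≤x , occ
      with greatest-witness (liveEndAt? N) (toℕ (ρ vx)) (pred (t + len⁺ (U j))) (end<x t (U j) t+l≤x)
             (j , live , t , end≡pred t (U j) , occ)
    ... | s , end≤s , s<x , ends , last =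
      from (existsLeftF-suc M N Ψ ρ) (inj₂ (⇒firstLiveF M (⇒existsLeftF M) N Ψ onlyY ≤M ρ y sF
        (subst (toℕ y <_) (sym s≡) y<s) (subst (_< toℕ (ρ vx)) (sym s≡) s<x)
        (λ j live t occ s+2≤t+l t+l≤x → last (pred (t + len⁺ (U j)))
            (subst (_< pred (t + len⁺ (U j))) s≡ (pred-mono-≤ s+2≤t+l))
            (end<x t (U j) t+l≤x) (j , live , t , end≡pred t (U j) , occ))
        (subst (λ q → Σ (Fin J) λ j → (1 ≤ lookup N j) × OccursEndingAt (U j) w q) (sym s≡) ends) body))
      where
      y<s : toℕ y < s
      y<s = <-≤-trans y<t (≤-trans (pred-mono-≤ (m<m+n t (1≤len⁺ (U j)))) end≤s)
      sF = fromℕ< (<-trans s<x (toℕ<n (ρ vx)))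
      s≡ : toℕ sF ≡ s
      s≡ = toℕ-fromℕ< _

    SatBet-existsLeftF : ∀ N Ψ → OnlyY w Ψ → ∀ ρ → SatBet w ρ (existsLeftF (sum N) N Ψ) ⇔ ExistsLeft N Ψ ρ
    SatBet-existsLeftF N Ψ onlyY ρ =
      mk⇔ (existsLeftF⇒ _ N Ψ onlyY ≤-refl ρ) (⇒existsLeftF _ N Ψ onlyY ≤-refl ρ)

-- Matrices: Boolean combinations of atoms and of already translated formulas

data Matrix (k : ℕ) : Set where
  mLetter : Fin k → Var → Matrix k
  mEq mLt : Var → Var → Matrix k
  mFac : List⁺ (Fin k) → ℕ → Var → Var → Matrix k
  mBet : Var → FOBet k → Matrix k
  mConst : Bool → Matrix k
  mNot : Matrix k → Matrix k
  mAnd : Matrix k → Matrix k → Matrix k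

SatM : ∀ {k} (w : Word k) → Assign w → Matrix k → Set
SatM w ρ (mLetter a v) = List.lookup w (ρ v) ≡ a
SatM w ρ (mEq v v') = ρ v ≡ ρ v'
SatM w ρ (mLt v v') = toℕ (ρ v) < toℕ (ρ v')
SatM w ρ (mFac u n v v') = thfacI w (u , n) (toℕ (ρ v)) (toℕ (ρ v'))
SatM w ρ (mBet v Φ) = SatBet w ρ Φ
SatM w ρ (mConst b) = T b
SatM w ρ (mNot m) = ¬ SatM w ρ m
SatM w ρ (mAnd m m') = SatM w ρ m × SatM w ρ m'

module _ {k : ℕ} (w : Word k) where

  open Assignments w

  SatM-agree : ∀ (ρ ρ' : Assign w) → (∀ v → ρ v ≡ ρ' v) → ∀ m → SatM w ρ m → SatM w ρ' m
  SatM-agree ρ ρ' e (mLetter a v) s = trans (cong (List.lookup w) (sym (e v))) s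
  SatM-agree ρ ρ' e (mEq v v') s = trans (sym (e v)) (trans s (e v'))
  SatM-agree ρ ρ' e (mLt v v') s rewrite sym (e v) | sym (e v') = s
  SatM-agree ρ ρ' e (mFac u n v v') s rewrite sym (e v) | sym (e v') = s
  SatM-agree ρ ρ' e (mBet v Φ) s = to (Sat-ext betfacI w Φ ρ ρ' e) s
  SatM-agree ρ ρ' e (mConst b) s = s
  SatM-agree ρ ρ' e (mNot m) s s' = s (SatM-agree ρ' ρ (λ v → sym (e v)) m s')
  SatM-agree ρ ρ' e (mAnd m m') (s , s') = SatM-agree ρ ρ' e m s , SatM-agree ρ ρ' e m' s'

  SatM-ext : ∀ (ρ ρ' : Assign w) → (∀ v → ρ v ≡ ρ' v) → ∀ m → SatM w ρ m ⇔ SatM w ρ' m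
  SatM-ext ρ ρ' e m = mk⇔ (SatM-agree ρ ρ' e m) (SatM-agree ρ' ρ (λ v → sym (e v)) m)

Ignores : ∀ {k} → Var → FOBet k → Set
Ignores {k} v Φ = ∀ (w : Word k) (ρ : Assign w) i → SatBet w ρ Φ ⇔ SatBet w (update {w = w} ρ v i) Φ

-- Every embedded formula mBet v Φ stands for a quantification over v, so it must not depend on v.
WellScoped : ∀ {k} → Matrix k → Set
WellScoped (mBet v Φ) = Ignores v Φ
WellScoped (mNot m) = WellScoped m
WellScoped (mAnd m m') = WellScoped m × WellScoped m'
WellScoped _ = ⊤

swapMatrix : ∀ {k} → Matrix k → Matrix k
swapMatrix (mLetter a v) = mLetter a (swapVar v)
swapMatrix (mEq v v') = mEq (swapVar v) (swapVar v')
swapMatrix (mLt v v') = mLt (swapVar v) (swapVar v')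
swapMatrix (mFac u n v v') = mFac u n (swapVar v) (swapVar v')
swapMatrix (mBet v Φ) = mBet (swapVar v) (swapFormula Φ)
swapMatrix (mConst b) = mConst b
swapMatrix (mNot m) = mNot (swapMatrix m)
swapMatrix (mAnd m m') = mAnd (swapMatrix m) (swapMatrix m')

module _ {k : ℕ} (w : Word k) where

  open Assignments w

  SatM-swap : ∀ ρ m → SatM w ρ (swapMatrix m) ⇔ SatM w (swapAssign ρ) m
  SatM-swap ρ (mLetter a v) = ⇔.refl
  SatM-swap ρ (mEq v v') = ⇔.refl
  SatM-swap ρ (mLt v v') = ⇔.refl
  SatM-swap ρ (mFac u n v v') = ⇔.refl
  SatM-swap ρ (mBet v Φ) = Sat-swap betfacI w Φ ρ
  SatM-swap ρ (mConst b) = ⇔.refl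
  SatM-swap ρ (mNot m) = ¬-cong-⇔ (SatM-swap ρ m)
  SatM-swap ρ (mAnd m m') = SatM-swap ρ m ×-⇔ SatM-swap ρ m'

WellScoped-swap : ∀ {k} (m : Matrix k) → WellScoped m → WellScoped (swapMatrix m)
WellScoped-swap (mLetter a v) _ = tt
WellScoped-swap (mEq v v') _ = tt
WellScoped-swap (mLt v v') _ = tt
WellScoped-swap (mFac u n v v') _ = tt
WellScoped-swap (mConst b) _ = tt
WellScoped-swap (mNot m) ws = WellScoped-swap m ws
WellScoped-swap (mAnd m m') (ws , ws') = WellScoped-swap m ws , WellScoped-swap m' ws'
WellScoped-swap (mBet v Φ) ignores w ρ i = begin
  SatBet w ρ (swapFormula Φ)                         ≈⟨ Sat-swap betfacI w Φ ρ ⟩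
  SatBet w (swapAssign ρ) Φ                          ≈⟨ ignores w (swapAssign ρ) i ⟩
  SatBet w (swapAssign ρ [ v ↦ i ]) Φ                ≈⟨ Sat-ext betfacI w Φ _ _ (λ u → sym (update-swap ρ v i u)) ⟩
  SatBet w (swapAssign (ρ [ swapVar v ↦ i ])) Φ      ≈⟨ Sat-swap betfacI w Φ _ ⟨
  SatBet w (ρ [ swapVar v ↦ i ]) (swapFormula Φ)     ∎
  where
  open ⇔-Reasoning
  open Assignments w

-- Shannon expansion over the atoms that depend on x alone

XAtoms : ∀ {k} → Matrix k → Set
XAtoms (mLetter a vx) = Bool
XAtoms (mBet vy Φ) = Bool
XAtoms (mNot m) = XAtoms m
XAtoms (mAnd m m') = XAtoms m × XAtoms m'
XAtoms _ = ⊤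

NoXAtoms : ∀ {k} → Matrix k → Set
NoXAtoms (mLetter a vx) = ⊥
NoXAtoms (mBet vy Φ) = ⊥
NoXAtoms (mNot m) = NoXAtoms m
NoXAtoms (mAnd m m') = NoXAtoms m × NoXAtoms m'
NoXAtoms _ = ⊤

fixX : ∀ {k} (m : Matrix k) → XAtoms m → Matrix k
fixX (mLetter a vx) b = mConst b
fixX (mLetter a vy) b = mLetter a vy
fixX (mEq v v') b = mEq v v'
fixX (mLt v v') b = mLt v v'
fixX (mFac u n v v') b = mFac u n v v'
fixX (mBet vx Φ) b = mBet vx Φ
fixX (mBet vy Φ) b = mConst b
fixX (mConst c) b = mConst c
fixX (mNot m) b = mNot (fixX m b)
fixX (mAnd m m') (b , b') = mAnd (fixX m b) (fixX m' b')

NoXAtoms-fixX : ∀ {k} (m : Matrix k) b → NoXAtoms (fixX m b)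
NoXAtoms-fixX (mLetter a vx) b = tt
NoXAtoms-fixX (mLetter a vy) b = tt
NoXAtoms-fixX (mEq v v') b = tt
NoXAtoms-fixX (mLt v v') b = tt
NoXAtoms-fixX (mFac u n v v') b = tt
NoXAtoms-fixX (mBet vx Φ) b = tt
NoXAtoms-fixX (mBet vy Φ) b = tt
NoXAtoms-fixX (mConst c) b = tt
NoXAtoms-fixX (mNot m) b = NoXAtoms-fixX m b
NoXAtoms-fixX (mAnd m m') (b , b') = NoXAtoms-fixX m b , NoXAtoms-fixX m' b'

WellScoped-fixX : ∀ {k} (m : Matrix k) b → WellScoped m → WellScoped (fixX m b)
WellScoped-fixX (mLetter a vx) b ws = tt
WellScoped-fixX (mLetter a vy) b ws = tt
WellScoped-fixX (mEq v v') b ws = tt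
WellScoped-fixX (mLt v v') b ws = tt
WellScoped-fixX (mFac u n v v') b ws = tt
WellScoped-fixX (mBet vx Φ) b ws = ws
WellScoped-fixX (mBet vy Φ) b ws = tt
WellScoped-fixX (mConst c) b ws = tt
WellScoped-fixX (mNot m) b ws = WellScoped-fixX m b ws
WellScoped-fixX (mAnd m m') (b , b') (ws , ws') = WellScoped-fixX m b ws , WellScoped-fixX m' b' ws'

xValues : ∀ {k} (m : Matrix k) (w : Word k) → Assign w → XAtoms m
xValues (mLetter a vx) w ρ = does (List.lookup w (ρ vx) Fin.≟ a)
xValues (mLetter a vy) w ρ = tt
xValues (mEq v v') w ρ = tt
xValues (mLt v v') w ρ = tt
xValues (mFac u n v v') w ρ = tt
xValues (mBet vx Φ) w ρ = tt
xValues (mBet vy Φ) w ρ = does (SatBet? w ρ Φ)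
xValues (mConst c) w ρ = tt
xValues (mNot m) w ρ = xValues m w ρ
xValues (mAnd m m') w ρ = xValues m w ρ , xValues m' w ρ

xAtomsF : ∀ {k} (m : Matrix k) → XAtoms m → FOBet k
xAtomsF (mLetter a vx) b = literal b (letter a vx)
xAtomsF (mBet vy Φ) b = literal b Φ
xAtomsF (mNot m) b = xAtomsF m b
xAtomsF (mAnd m m') (b , b') = xAtomsF m b ∧' xAtomsF m' b'
xAtomsF (mLetter a vy) b = ⊤F
xAtomsF (mEq v v') b = ⊤F
xAtomsF (mLt v v') b = ⊤F
xAtomsF (mFac u n v v') b = ⊤F
xAtomsF (mBet vx Φ) b = ⊤F
xAtomsF (mConst c) b = ⊤F

OrXAtoms : ∀ {k} (m : Matrix k) → (XAtoms m → FOBet k) → FOBet k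
OrXAtoms (mLetter a vx) f = f true ∨F f false
OrXAtoms (mBet vy Φ) f = f true ∨F f false
OrXAtoms (mNot m) f = OrXAtoms m f
OrXAtoms (mAnd m m') f = OrXAtoms m (λ b → OrXAtoms m' (λ b' → f (b , b')))
OrXAtoms (mLetter a vy) f = f tt
OrXAtoms (mEq v v') f = f tt
OrXAtoms (mLt v v') f = f tt
OrXAtoms (mFac u n v v') f = f tt
OrXAtoms (mBet vx Φ) f = f tt
OrXAtoms (mConst c) f = f tt

module _ {k : ℕ} (w : Word k) where

  open Assignments w

  T-does : ∀ {A : Set} (A? : Dec A) → T (does A?) ⇔ A
  T-does (yes a) = mk⇔ (λ _ → a) _
  T-does (no ¬a) = mk⇔ (λ ()) ¬a

  SatM-fixX : ∀ ρ (m : Matrix k) → SatM w ρ m ⇔ SatM w ρ (fixX m (xValues m w ρ))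
  SatM-fixX ρ (mLetter a vx) = ⇔.sym (T-does (List.lookup w (ρ vx) Fin.≟ a))
  SatM-fixX ρ (mLetter a vy) = ⇔.refl
  SatM-fixX ρ (mEq v v') = ⇔.refl
  SatM-fixX ρ (mLt v v') = ⇔.refl
  SatM-fixX ρ (mFac u n v v') = ⇔.refl
  SatM-fixX ρ (mBet vx Φ) = ⇔.refl
  SatM-fixX ρ (mBet vy Φ) = ⇔.sym (T-does (SatBet? w ρ Φ))
  SatM-fixX ρ (mConst c) = ⇔.refl
  SatM-fixX ρ (mNot m) = ¬-cong-⇔ (SatM-fixX ρ m)
  SatM-fixX ρ (mAnd m m') = SatM-fixX ρ m ×-⇔ SatM-fixX ρ m'

  xValues-update-y : ∀ ρ i (m : Matrix k) → WellScoped m → xValues m w (ρ [ vy ↦ i ]) ≡ xValues m w ρ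
  xValues-update-y ρ i (mLetter a vx) ws = refl
  xValues-update-y ρ i (mLetter a vy) ws = refl
  xValues-update-y ρ i (mEq v v') ws = refl
  xValues-update-y ρ i (mLt v v') ws = refl
  xValues-update-y ρ i (mFac u n v v') ws = refl
  xValues-update-y ρ i (mBet vx Φ) ws = refl
  xValues-update-y ρ i (mBet vy Φ) ignores = does-⇔ (⇔.sym (ignores w ρ i)) (SatBet? w _ Φ) (SatBet? w ρ Φ)
  xValues-update-y ρ i (mConst c) ws = refl
  xValues-update-y ρ i (mNot m) ws = xValues-update-y ρ i m ws
  xValues-update-y ρ i (mAnd m m') (ws , ws') = cong₂ _,_ (xValues-update-y ρ i m ws) (xValues-update-y ρ i m' ws')

  private
    SatBet-⊤F-tt : ∀ ρ (b : ⊤) → SatBet w ρ ⊤F ⇔ (b ≡ tt)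
    SatBet-⊤F-tt ρ b = mk⇔ (λ _ → refl) (λ _ → Sat-⊤ betfacI w ρ)

  SatBet-xAtomsF : ∀ ρ (m : Matrix k) b → SatBet w ρ (xAtomsF m b) ⇔ (b ≡ xValues m w ρ)
  SatBet-xAtomsF ρ (mLetter a vx) b = Sat-literal⇔ betfacI w ρ (letter a vx) (List.lookup w (ρ vx) Fin.≟ a) ⇔.refl b
  SatBet-xAtomsF ρ (mBet vy Φ) b = Sat-literal⇔ betfacI w ρ Φ (SatBet? w ρ Φ) ⇔.refl b
  SatBet-xAtomsF ρ (mNot m) b = SatBet-xAtomsF ρ m b
  SatBet-xAtomsF ρ (mAnd m m') (b , b') = mk⇔
    (λ (s , s') → cong₂ _,_ (to (SatBet-xAtomsF ρ m b) s) (to (SatBet-xAtomsF ρ m' b') s'))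
    (λ { refl → from (SatBet-xAtomsF ρ m b) refl , from (SatBet-xAtomsF ρ m' b') refl })
  SatBet-xAtomsF ρ (mLetter a vy) b = SatBet-⊤F-tt ρ b
  SatBet-xAtomsF ρ (mEq v v') b = SatBet-⊤F-tt ρ b
  SatBet-xAtomsF ρ (mLt v v') b = SatBet-⊤F-tt ρ b
  SatBet-xAtomsF ρ (mFac u n v v') b = SatBet-⊤F-tt ρ b
  SatBet-xAtomsF ρ (mBet vx Φ) b = SatBet-⊤F-tt ρ b
  SatBet-xAtomsF ρ (mConst c) b = SatBet-⊤F-tt ρ b

  private
    SatBet-∨-Bool : ∀ ρ (f : Bool → FOBet k) → SatBet w ρ (f true ∨F f false) ⇔ Σ Bool (λ b → SatBet w ρ (f b))
    SatBet-∨-Bool ρ f = mk⇔ (λ s → [ (true ,_) , (false ,_) ]′ (to ∨-sem s))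
      (λ { (true , s) → from ∨-sem (inj₁ s) ; (false , s) → from ∨-sem (inj₂ s) })
      where ∨-sem = SatBet-∨ w ρ (f true) (f false)

    SatBet-Σ-⊤ : ∀ ρ (f : ⊤ → FOBet k) → SatBet w ρ (f tt) ⇔ Σ ⊤ (λ b → SatBet w ρ (f b))
    SatBet-Σ-⊤ ρ f = mk⇔ (tt ,_) proj₂

  SatBet-OrXAtoms : ∀ ρ (m : Matrix k) f → SatBet w ρ (OrXAtoms m f) ⇔ Σ (XAtoms m) (λ b → SatBet w ρ (f b))
  SatBet-OrXAtoms ρ (mLetter a vx) f = SatBet-∨-Bool ρ f
  SatBet-OrXAtoms ρ (mBet vy Φ) f = SatBet-∨-Bool ρ f
  SatBet-OrXAtoms ρ (mNot m) f = SatBet-OrXAtoms ρ m f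
  SatBet-OrXAtoms ρ (mAnd m m') f = mk⇔
    (λ s → let (b , s₁) = to (SatBet-OrXAtoms ρ m _) s ; (b' , s₂) = to (SatBet-OrXAtoms ρ m' _) s₁ in (b , b') , s₂)
    (λ ((b , b') , s) → from (SatBet-OrXAtoms ρ m _) (b , from (SatBet-OrXAtoms ρ m' (λ b' → f (b , b'))) (b' , s)))
  SatBet-OrXAtoms ρ (mLetter a vy) f = SatBet-Σ-⊤ ρ f
  SatBet-OrXAtoms ρ (mEq v v') f = SatBet-Σ-⊤ ρ f
  SatBet-OrXAtoms ρ (mLt v v') f = SatBet-Σ-⊤ ρ f
  SatBet-OrXAtoms ρ (mFac u n v v') f = SatBet-Σ-⊤ ρ f
  SatBet-OrXAtoms ρ (mBet vx Φ) f = SatBet-Σ-⊤ ρ f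
  SatBet-OrXAtoms ρ (mConst c) f = SatBet-Σ-⊤ ρ f

data Side : Set where
  right left : Side

lo hi : Side → Var
lo right = vx
lo left = vy
hi right = vy
hi left = vx

spans : Side → Var → Var → ℕ
spans right vx vy = 1
spans left vy vx = 1
spans _ _ _ = 0

spanCount : ∀ {k} → Side → Matrix k → ℕ
spanCount d (mFac u n v v') = spans d v v'
spanCount d (mNot m) = spanCount d m
spanCount d (mAnd m m') = spanCount d m + spanCount d m'
spanCount d _ = 0

spanFactor : ∀ {k} d (m : Matrix k) → Fin (spanCount d m) → List⁺ (Fin k)
spanFactor d (mFac u n v v') _ = u
spanFactor d (mNot m) i = spanFactor d m i
spanFactor d (mAnd m m') i = [ spanFactor d m , spanFactor d m' ]′ (splitAt (spanCount d m) i)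

spanThreshold : ∀ {k} d (m : Matrix k) → Fin (spanCount d m) → ℕ
spanThreshold d (mFac u n v v') _ = n
spanThreshold d (mNot m) i = spanThreshold d m i
spanThreshold d (mAnd m m') i = [ spanThreshold d m , spanThreshold d m' ]′ (splitAt (spanCount d m) i)

sideLess : Side → Var → Var → Bool
sideLess right vx vy = true
sideLess left vy vx = true
sideLess _ _ _ = false

-- An interval that is empty or runs backwards contains no occurrence, so only threshold 0 holds there.
factorAtCounts : ∀ {k J} d v v' → ℕ → (Fin (spans d v v') → Fin J) → Vec ℕ J → FOBet k
factorAtCounts right vx vy n ix c = constF (n ≤ᵇ lookup c (ix Fin.zero))
factorAtCounts left vy vx n ix c = constF (n ≤ᵇ lookup c (ix Fin.zero))
factorAtCounts right vx vx n ix c = constF (n ≡ᵇ 0)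
factorAtCounts right vy vx n ix c = constF (n ≡ᵇ 0)
factorAtCounts right vy vy n ix c = constF (n ≡ᵇ 0)
factorAtCounts left vx vx n ix c = constF (n ≡ᵇ 0)
factorAtCounts left vx vy n ix c = constF (n ≡ᵇ 0)
factorAtCounts left vy vy n ix c = constF (n ≡ᵇ 0)

atCounts : ∀ {k J} d (m : Matrix k) → (Fin (spanCount d m) → Fin J) → Vec ℕ J → FOBet k
atCounts d (mLetter a v) ix c = letter a v
atCounts d (mEq v v') ix c = constF (does (v ≟v v'))
atCounts d (mLt v v') ix c = constF (sideLess d v v')
atCounts d (mFac u n v v') ix c = factorAtCounts d v v' n ix c
atCounts d (mBet v Φ) ix c = Φ
atCounts d (mConst b) ix c = constF b
atCounts d (mNot m) ix c = ¬' atCounts d m ix c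
atCounts d (mAnd m m') ix c =
  atCounts d m (λ i → ix (i ↑ˡ spanCount d m')) c ∧' atCounts d m' (λ i → ix (spanCount d m ↑ʳ i)) c

≤ᵇ-⊓ : ∀ n c → T (n ≤ᵇ (c ⊓ n)) ⇔ (n ≤ c)
≤ᵇ-⊓ n c = mk⇔ (λ t → ≤-trans (≤ᵇ⇒≤ n (c ⊓ n) t) (m⊓n≤m c n))
                (λ le → ≤⇒≤ᵇ (≤-reflexive (sym (m≥n⇒m⊓n≡n le))))

≡ᵇ0-≤0 : ∀ n c → c ≡ 0 → T (n ≡ᵇ 0) ⇔ (n ≤ c)
≡ᵇ0-≤0 zero c refl = mk⇔ (λ _ → z≤n) _
≡ᵇ0-≤0 (suc n) c refl = mk⇔ (λ ()) (λ ())

occCount-backwards : ∀ {k} (u : List⁺ (Fin k)) (w : Word k) a b → b ≤ a → occCount u w a b ≡ 0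
occCount-backwards u w a b b≤a = occCount-short u w a b (≤-trans b≤a (m≤m+n a _))

module _ {k J : ℕ} (w : Word k) (U : Fin J → List⁺ (Fin k)) (N c : Vec ℕ J) (ρ : Assign w) where

  private
    SatBet-spanning : ∀ d {u n} (ix : Fin 1 → Fin J) → (∀ i → U (ix i) ≡ u) → (∀ i → lookup N (ix i) ≡ n) →
      (∀ j → lookup c j ≡ occCount (U j) w (toℕ (ρ (lo d))) (toℕ (ρ (hi d))) ⊓ lookup N j) →
      SatBet w ρ (constF (n ≤ᵇ lookup c (ix Fin.zero))) ⇔ (n ≤ occCount u w (toℕ (ρ (lo d))) (toℕ (ρ (hi d))))
    SatBet-spanning d {n = n} ix HU HN Hc rewrite Hc (ix Fin.zero) | HU Fin.zero | HN Fin.zero =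
      ⇔.trans (Sat-constF betfacI w ρ _) (≤ᵇ-⊓ n _)

    SatBet-empty : ∀ {a b} u n → b ≤ a → SatBet w ρ (constF (n ≡ᵇ 0)) ⇔ thfacI w (u , n) a b
    SatBet-empty u n b≤a = ⇔.trans (Sat-constF betfacI w ρ _) (≡ᵇ0-≤0 n _ (occCount-backwards u w _ _ b≤a))

  SatBet-factorAtCounts : ∀ d v v' u n (ix : Fin (spans d v v') → Fin J) →
    toℕ (ρ (lo d)) < toℕ (ρ (hi d)) → (∀ i → U (ix i) ≡ u) → (∀ i → lookup N (ix i) ≡ n) →
    (∀ j → lookup c j ≡ occCount (U j) w (toℕ (ρ (lo d))) (toℕ (ρ (hi d))) ⊓ lookup N j) →
    SatBet w ρ (factorAtCounts d v v' n ix c) ⇔ thfacI w (u , n) (toℕ (ρ v)) (toℕ (ρ v'))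
  SatBet-factorAtCounts right vx vy u n ix l HU HN Hc = SatBet-spanning right ix HU HN Hc
  SatBet-factorAtCounts left vy vx u n ix l HU HN Hc = SatBet-spanning left ix HU HN Hc
  SatBet-factorAtCounts right vx vx u n ix l HU HN Hc = SatBet-empty u n ≤-refl
  SatBet-factorAtCounts right vy vy u n ix l HU HN Hc = SatBet-empty u n ≤-refl
  SatBet-factorAtCounts left vx vx u n ix l HU HN Hc = SatBet-empty u n ≤-refl
  SatBet-factorAtCounts left vy vy u n ix l HU HN Hc = SatBet-empty u n ≤-refl
  SatBet-factorAtCounts right vy vx u n ix l HU HN Hc = SatBet-empty u n (<⇒≤ l)
  SatBet-factorAtCounts left vx vy u n ix l HU HN Hc = SatBet-empty u n (<⇒≤ l)

  SatBet-atCounts : ∀ d → toℕ (ρ (lo d)) < toℕ (ρ (hi d)) →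
    (∀ j → lookup c j ≡ occCount (U j) w (toℕ (ρ (lo d))) (toℕ (ρ (hi d))) ⊓ lookup N j) →
    ∀ (m : Matrix k) (ix : Fin (spanCount d m) → Fin J) →
    (∀ i → U (ix i) ≡ spanFactor d m i) → (∀ i → lookup N (ix i) ≡ spanThreshold d m i) →
    SatBet w ρ (atCounts d m ix c) ⇔ SatM w ρ m
  SatBet-atCounts d l Hc (mLetter a v) ix HU HN = ⇔.refl
  SatBet-atCounts d l Hc (mEq v v') ix HU HN with v ≟v v'
  ... | yes refl = mk⇔ (λ _ → refl) (λ _ → Sat-⊤ betfacI w ρ)
  ... | no v≢v′ = ⇔.trans (Sat-constF betfacI w ρ false) (mk⇔ (λ ()) (distinct d l v v' v≢v′))
    where
    distinct : ∀ d → toℕ (ρ (lo d)) < toℕ (ρ (hi d)) → ∀ v v' → ¬ v ≡ v' → ¬ ρ v ≡ ρ v'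
    distinct _ _ vx vx v≢v′ _ = v≢v′ refl
    distinct _ _ vy vy v≢v′ _ = v≢v′ refl
    distinct right l vx vy _ e = <-irrefl (cong toℕ e) l
    distinct left l vx vy _ e = <-irrefl (cong toℕ (sym e)) l
    distinct right l vy vx _ e = <-irrefl (cong toℕ (sym e)) l
    distinct left l vy vx _ e = <-irrefl (cong toℕ e) l
  SatBet-atCounts d l Hc (mLt v v') ix HU HN = ⇔.trans (Sat-constF betfacI w ρ (sideLess d v v')) (less d v v' l)
    where
    less : ∀ d v v' → toℕ (ρ (lo d)) < toℕ (ρ (hi d)) → T (sideLess d v v') ⇔ (toℕ (ρ v) < toℕ (ρ v'))
    less right vx vy l = mk⇔ (λ _ → l) _
    less left vy vx l = mk⇔ (λ _ → l) _
    less right vx vx l = mk⇔ (λ ()) (λ l' → <-irrefl refl l')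
    less right vy vy l = mk⇔ (λ ()) (λ l' → <-irrefl refl l')
    less left vx vx l = mk⇔ (λ ()) (λ l' → <-irrefl refl l')
    less left vy vy l = mk⇔ (λ ()) (λ l' → <-irrefl refl l')
    less right vy vx l = mk⇔ (λ ()) (λ l' → <-asym l l')
    less left vx vy l = mk⇔ (λ ()) (λ l' → <-asym l l')
  SatBet-atCounts d l Hc (mFac u n v v') ix HU HN = SatBet-factorAtCounts d v v' u n ix l HU HN Hc
  SatBet-atCounts d l Hc (mBet v Φ) ix HU HN = ⇔.refl
  SatBet-atCounts d l Hc (mConst b) ix HU HN = Sat-constF betfacI w ρ b
  SatBet-atCounts d l Hc (mNot m) ix HU HN = ¬-cong-⇔ (SatBet-atCounts d l Hc m ix HU HN)
  SatBet-atCounts d l Hc (mAnd m m') ix HU HN =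
    SatBet-atCounts d l Hc m (λ i → ix (i ↑ˡ spanCount d m'))
      (λ i → trans (HU (i ↑ˡ _)) (cong [ spanFactor d m , spanFactor d m' ]′ (splitAt-↑ˡ (spanCount d m) i _)))
      (λ i → trans (HN (i ↑ˡ _)) (cong [ spanThreshold d m , spanThreshold d m' ]′ (splitAt-↑ˡ (spanCount d m) i _)))
    ×-⇔
    SatBet-atCounts d l Hc m' (λ i → ix (spanCount d m ↑ʳ i))
      (λ i → trans (HU (_ ↑ʳ i)) (cong [ spanFactor d m , spanFactor d m' ]′ (splitAt-↑ʳ (spanCount d m) _ i)))
      (λ i → trans (HN (_ ↑ʳ i)) (cong [ spanThreshold d m , spanThreshold d m' ]′ (splitAt-↑ʳ (spanCount d m) _ i)))

constF-ignores : ∀ {k} (w : Word k) (ρ ρ' : Assign w) b → SatBet w ρ (constF b) ⇔ SatBet w ρ' (constF b)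
constF-ignores w ρ ρ' b = ⇔.trans (Sat-constF betfacI w ρ b) (⇔.sym (Sat-constF betfacI w ρ' b))

factorAtCounts-ignores : ∀ {k J} (w : Word k) (ρ ρ' : Assign w) d v v' n (ix : Fin (spans d v v') → Fin J) c →
  SatBet w ρ (factorAtCounts d v v' n ix c) ⇔ SatBet w ρ' (factorAtCounts d v v' n ix c)
factorAtCounts-ignores w ρ ρ' right vx vy n ix c = constF-ignores w ρ ρ' (n ≤ᵇ lookup c (ix Fin.zero))
factorAtCounts-ignores w ρ ρ' left vy vx n ix c = constF-ignores w ρ ρ' (n ≤ᵇ lookup c (ix Fin.zero))
factorAtCounts-ignores w ρ ρ' right vx vx n ix c = constF-ignores w ρ ρ' (n ≡ᵇ 0)
factorAtCounts-ignores w ρ ρ' right vy vx n ix c = constF-ignores w ρ ρ' (n ≡ᵇ 0)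
factorAtCounts-ignores w ρ ρ' right vy vy n ix c = constF-ignores w ρ ρ' (n ≡ᵇ 0)
factorAtCounts-ignores w ρ ρ' left vx vx n ix c = constF-ignores w ρ ρ' (n ≡ᵇ 0)
factorAtCounts-ignores w ρ ρ' left vx vy n ix c = constF-ignores w ρ ρ' (n ≡ᵇ 0)
factorAtCounts-ignores w ρ ρ' left vy vy n ix c = constF-ignores w ρ ρ' (n ≡ᵇ 0)

atCounts-onlyY : ∀ {k J} d (m : Matrix k) (ix : Fin (spanCount d m) → Fin J) c → NoXAtoms m → WellScoped m →
  ∀ (w : Word k) (ρ ρ' : Assign w) → ρ vy ≡ ρ' vy →
  SatBet w ρ (atCounts d m ix c) ⇔ SatBet w ρ' (atCounts d m ix c)
atCounts-onlyY d (mLetter a vy) ix c _ _ w ρ ρ' e rewrite e = ⇔.refl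
atCounts-onlyY d (mEq v v') ix c _ _ w ρ ρ' e = constF-ignores w ρ ρ' (does (v ≟v v'))
atCounts-onlyY d (mLt v v') ix c _ _ w ρ ρ' e = constF-ignores w ρ ρ' (sideLess d v v')
atCounts-onlyY d (mFac u n v v') ix c _ _ w ρ ρ' e = factorAtCounts-ignores w ρ ρ' d v v' n ix c
atCounts-onlyY d (mBet vx Φ) ix c _ ignores w ρ ρ' e =
  ⇔.trans (ignores w ρ (ρ' vx)) (Sat-ext betfacI w Φ _ _ λ { vx → refl ; vy → e })
atCounts-onlyY d (mConst b) ix c _ _ w ρ ρ' e = constF-ignores w ρ ρ' b
atCounts-onlyY d (mNot m) ix c nx ws w ρ ρ' e = ¬-cong-⇔ (atCounts-onlyY d m ix c nx ws w ρ ρ' e)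
atCounts-onlyY d (mAnd m m') ix c (nx , nx') (ws , ws') w ρ ρ' e =
  atCounts-onlyY d m _ c nx ws w ρ ρ' e ×-⇔ atCounts-onlyY d m' _ c nx' ws' w ρ ρ' e

-- Translating a quantification ∃y over a matrix

module SideScan {k : ℕ} (d : Side) (m : Matrix k) where

  J : ℕ
  J = spanCount d m

  U : Fin J → List⁺ (Fin k)
  U = spanFactor d m

  -- Any cap D ≥ 1 bounding every factor length works.
  D : ℕ
  D = suc (sum (tabulate (λ j → len⁺ (U j))))

  N : Vec ℕ J
  N = tabulate (spanThreshold d m)

  Ψ : Vec ℕ J → ℕ → FOBet k
  Ψ c _ = atCounts d m (λ i → i) c

  |U|≤D : ∀ j → len⁺ (U j) ≤ D
  |U|≤D j = ≤-trans (subst (_≤ _) (lookup∘tabulate _ j) (lookup≤sum (tabulate (λ j → len⁺ (U j))) j)) (n≤1+n _)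

  open CappedCounts J U D

  onlyY : NoXAtoms m → WellScoped m → ∀ w → OnlyY w Ψ
  onlyY nx ws w c e ρ ρ' eq = to (atCounts-onlyY d m (λ i → i) c nx ws w ρ ρ' eq)

  SatBet-Ψ : ∀ (w : Word k) (ρ : Assign w) → toℕ (ρ (lo d)) < toℕ (ρ (hi d)) →
    SatBet w ρ (Ψ (cap N (countsBetween w (toℕ (ρ (lo d))) (toℕ (ρ (hi d))))) 0) ⇔ SatM w ρ m
  SatBet-Ψ w ρ l = SatBet-atCounts w U N _ ρ d l capped m (λ i → i) (λ i → refl) (lookup∘tabulate (spanThreshold d m))
    where
    capped : ∀ j → lookup (cap N (countsBetween w _ _)) j ≡ occCount (U j) w _ _ ⊓ lookup N j
    capped j = trans (lookup∘tabulate _ j) (cong (_⊓ lookup N j) (lookup∘tabulate _ j))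

existsSideF : ∀ {k} → Side → Matrix k → FOBet k
existsSideF right m = Rightward.existsRightF J U D (sum N) N Ψ where open SideScan right m
existsSideF left m = Leftward.existsLeftF J U D (sum N) N Ψ where open SideScan left m

Beyond : Side → ℕ → ℕ → Set
Beyond right x y = x < y
Beyond left x y = y < x

module _ {k : ℕ} (w : Word k) where

  open Assignments w

  SatBet-existsSideF : ∀ d (m : Matrix k) → NoXAtoms m → WellScoped m → ∀ ρ →
    SatBet w ρ (existsSideF d m) ⇔
    Σ (Fin (length w)) (λ y → Beyond d (toℕ (ρ vx)) (toℕ y) × SatM w (ρ [ vy ↦ y ]) m)
  SatBet-existsSideF right m nx ws ρ =
    ⇔.trans (Rightward.SatBet-existsRightF J U D w |U|≤D (s≤s z≤n) N Ψ (onlyY nx ws w) ρ)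
            (Σ-⇔ λ y → Σ-⇔ λ x<y → SatBet-Ψ w (ρ [ vy ↦ y ]) x<y)
    where open SideScan right m
  SatBet-existsSideF left m nx ws ρ =
    ⇔.trans (Leftward.SatBet-existsLeftF J U D w |U|≤D (s≤s z≤n) N Ψ (onlyY nx ws w) ρ)
            (Σ-⇔ λ y → Σ-⇔ λ y<x → SatBet-Ψ w (ρ [ vy ↦ y ]) y<x)
    where open SideScan left m

sideF : ∀ {k} → Side → Matrix k → FOBet k
sideF d m = OrXAtoms m (λ b → xAtomsF m b ∧' existsSideF d (fixX m b))

-- The matrix evaluated at x = y, where every factor interval is empty.
diagonalF : ∀ {k} → Matrix k → FOBet k
diagonalF (mLetter a v) = letter a v
diagonalF (mEq v v') = v ≐ v'
diagonalF (mLt v v') = v ≺ v'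
diagonalF (mFac u n v v') = constF (n ≡ᵇ 0)
diagonalF (mBet v Φ) = Φ
diagonalF (mConst b) = constF b
diagonalF (mNot m) = ¬' diagonalF m
diagonalF (mAnd m m') = diagonalF m ∧' diagonalF m'

atDiagonalF : ∀ {k} → Matrix k → FOBet k
atDiagonalF m = ∃' vy ((vy ≐ vx) ∧' diagonalF m)

existsYF : ∀ {k} → Matrix k → FOBet k
existsYF m = atDiagonalF m ∨F (sideF right m ∨F sideF left m)

existsF : ∀ {k} → Var → Matrix k → FOBet k
existsF vy m = existsYF m
existsF vx m = ∃' vx ((vx ≐ vy) ∧' existsYF (swapMatrix m))

module _ {k : ℕ} (w : Word k) where

  open Assignments w

  SatBet-sideF : ∀ d (m : Matrix k) → WellScoped m → ∀ ρ →
    SatBet w ρ (sideF d m) ⇔ Σ (Fin (length w)) (λ y → Beyond d (toℕ (ρ vx)) (toℕ y) × SatM w (ρ [ vy ↦ y ]) m)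
  SatBet-sideF d m ws ρ = mk⇔ found witness
    where
    side = λ b → SatBet-existsSideF w d (fixX m b) (NoXAtoms-fixX m b) (WellScoped-fixX m b ws) ρ
    fixed : ∀ y → SatM w (ρ [ vy ↦ y ]) m ⇔ SatM w (ρ [ vy ↦ y ]) (fixX m (xValues m w ρ))
    fixed y = subst (λ b → SatM w (ρ [ vy ↦ y ]) m ⇔ SatM w (ρ [ vy ↦ y ]) (fixX m b))
                (xValues-update-y w ρ y m ws) (SatM-fixX w (ρ [ vy ↦ y ]) m)
    found : _ → _
    found s with to (SatBet-OrXAtoms w ρ m (λ b → xAtomsF m b ∧' existsSideF d (fixX m b))) s
    ... | b , values , s′ with to (SatBet-xAtomsF w ρ m b) values | to (side b) s′
    ... | refl | y , beyond , s″ = y , beyond , from (fixed y) s″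
    witness : _ → _
    witness (y , beyond , s) = from (SatBet-OrXAtoms w ρ m (λ b → xAtomsF m b ∧' existsSideF d (fixX m b)))
      (xValues m w ρ , from (SatBet-xAtomsF w ρ m _) refl , from (side _) (y , beyond , to (fixed y) s))

  SatBet-diagonalF : ∀ (ρ : Assign w) → ρ vx ≡ ρ vy → ∀ m → SatBet w ρ (diagonalF m) ⇔ SatM w ρ m
  SatBet-diagonalF ρ x≡y (mLetter a v) = ⇔.refl
  SatBet-diagonalF ρ x≡y (mEq v v') = ⇔.refl
  SatBet-diagonalF ρ x≡y (mLt v v') = ⇔.refl
  SatBet-diagonalF ρ x≡y (mFac u n v v') = ⇔.trans (Sat-constF betfacI w ρ _)
    (≡ᵇ0-≤0 n _ (occCount-backwards u w _ _ (≤-reflexive (cong toℕ (same v' v)))))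
    where
    same : ∀ a b → ρ a ≡ ρ b
    same vx vx = refl
    same vy vy = refl
    same vx vy = x≡y
    same vy vx = sym x≡y
  SatBet-diagonalF ρ x≡y (mBet v Φ) = ⇔.refl
  SatBet-diagonalF ρ x≡y (mConst b) = Sat-constF betfacI w ρ b
  SatBet-diagonalF ρ x≡y (mNot m) = ¬-cong-⇔ (SatBet-diagonalF ρ x≡y m)
  SatBet-diagonalF ρ x≡y (mAnd m m') = SatBet-diagonalF ρ x≡y m ×-⇔ SatBet-diagonalF ρ x≡y m'

  SatBet-atDiagonalF : ∀ ρ m → SatBet w ρ (atDiagonalF m) ⇔ SatM w (ρ [ vy ↦ ρ vx ]) m
  SatBet-atDiagonalF ρ m = mk⇔ (λ { (i , refl , s) → to (SatBet-diagonalF _ refl m) s })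
                               (λ s → ρ vx , refl , from (SatBet-diagonalF _ refl m) s)

  SatBet-existsYF : ∀ (m : Matrix k) → WellScoped m → ∀ ρ →
    SatBet w ρ (existsYF m) ⇔ Σ (Fin (length w)) (λ y → SatM w (ρ [ vy ↦ y ]) m)
  SatBet-existsYF m ws ρ = mk⇔ found witness
    where
    cases = SatBet-∨ w ρ (atDiagonalF m) (sideF right m ∨F sideF left m)
    sides = SatBet-∨ w ρ (sideF right m) (sideF left m)
    found : _ → _
    found s with to cases s
    ... | inj₁ s = ρ vx , to (SatBet-atDiagonalF ρ m) s
    ... | inj₂ s with to sides s
    ... | inj₁ s = let (y , _ , s′) = to (SatBet-sideF right m ws ρ) s in y , s′
    ... | inj₂ s = let (y , _ , s′) = to (SatBet-sideF left m ws ρ) s in y , s′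
    witness : _ → _
    witness (y , s) with <-cmp (toℕ y) (toℕ (ρ vx))
    ... | tri< y<x _ _ = from cases (inj₂ (from sides (inj₂ (from (SatBet-sideF left m ws ρ) (y , y<x , s)))))
    ... | tri> _ _ x<y = from cases (inj₂ (from sides (inj₁ (from (SatBet-sideF right m ws ρ) (y , x<y , s)))))
    ... | tri≈ _ y≡x _ = from cases (inj₁ (from (SatBet-atDiagonalF ρ m)
                           (subst (λ y → SatM w (ρ [ vy ↦ y ]) m) (toℕ-injective y≡x) s)))

  -- ∃x is reduced to ∃y by swapping the variables, then the result is moved back from x to y.
  SatBet-existsF : ∀ (m : Matrix k) → WellScoped m → ∀ v ρ →
    SatBet w ρ (existsF v m) ⇔ Σ (Fin (length w)) (λ i → SatM w (ρ [ v ↦ i ]) m)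
  SatBet-existsF m ws vy ρ = SatBet-existsYF m ws ρ
  SatBet-existsF m ws vx ρ = mk⇔ found witness
    where
    swapped : ∀ j i → j ≡ ρ vy → ∀ v → swapAssign (ρ [ vx ↦ j ] [ vy ↦ i ]) v ≡ (ρ [ vx ↦ i ]) v
    swapped j i e vx = refl
    swapped j i e vy = e
    existsY = λ j → SatBet-existsYF (swapMatrix m) (WellScoped-swap m ws) (ρ [ vx ↦ j ])
    found : _ → _
    found (j , j≡y , s) with to (existsY j) s
    ... | i , s′ = i , to (SatM-ext w _ _ (swapped j i j≡y) m) (to (SatM-swap w _ m) s′)
    witness : _ → _
    witness (i , s) = ρ vy , refl ,
      from (existsY (ρ vy)) (i , from (SatM-swap w _ m) (from (SatM-ext w _ _ (swapped (ρ vy) i refl) m) s))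

Ignores-existsF : ∀ {k} (m : Matrix k) → WellScoped m → ∀ v → Ignores v (existsF v m)
Ignores-existsF m ws v w ρ i = begin
  SatBet w ρ (existsF v m)                                    ≈⟨ SatBet-existsF w m ws v ρ ⟩
  Σ (Fin (length w)) (λ j → SatM w (ρ [ v ↦ j ]) m)           ≈⟨ Σ-⇔ (λ j → SatM-ext w _ _ (λ u → sym (update-twice ρ v i j u)) m) ⟩
  Σ (Fin (length w)) (λ j → SatM w (ρ [ v ↦ i ] [ v ↦ j ]) m) ≈⟨ SatBet-existsF w m ws v (ρ [ v ↦ i ]) ⟨
  SatBet w (ρ [ v ↦ i ]) (existsF v m)                        ∎
  where
  open ⇔-Reasoning
  open Assignments w

toMatrix : ∀ {k} → FOTh k → Matrix k
toMatrix (letter a v) = mLetter a v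
toMatrix (v ≐ v') = mEq v v'
toMatrix (v ≺ v') = mLt v v'
toMatrix (bin (u , n) v v') = mFac u n v v'
toMatrix (¬' φ) = mNot (toMatrix φ)
toMatrix (φ ∧' ψ) = mAnd (toMatrix φ) (toMatrix ψ)
toMatrix (∃' v φ) = mBet v (existsF v (toMatrix φ))

WellScoped-toMatrix : ∀ {k} (φ : FOTh k) → WellScoped (toMatrix φ)
WellScoped-toMatrix (letter a v) = tt
WellScoped-toMatrix (v ≐ v') = tt
WellScoped-toMatrix (v ≺ v') = tt
WellScoped-toMatrix (bin (u , n) v v') = tt
WellScoped-toMatrix (¬' φ) = WellScoped-toMatrix φ
WellScoped-toMatrix (φ ∧' ψ) = WellScoped-toMatrix φ , WellScoped-toMatrix ψ
WellScoped-toMatrix (∃' v φ) = Ignores-existsF (toMatrix φ) (WellScoped-toMatrix φ) v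

SatM-toMatrix : ∀ {k} (φ : FOTh k) (w : Word k) ρ → SatM w ρ (toMatrix φ) ⇔ SatTh w ρ φ
SatM-toMatrix (letter a v) w ρ = ⇔.refl
SatM-toMatrix (v ≐ v') w ρ = ⇔.refl
SatM-toMatrix (v ≺ v') w ρ = ⇔.refl
SatM-toMatrix (bin (u , n) v v') w ρ = ⇔.refl
SatM-toMatrix (¬' φ) w ρ = ¬-cong-⇔ (SatM-toMatrix φ w ρ)
SatM-toMatrix (φ ∧' ψ) w ρ = SatM-toMatrix φ w ρ ×-⇔ SatM-toMatrix ψ w ρ
SatM-toMatrix (∃' v φ) w ρ =
  ⇔.trans (SatBet-existsF w (toMatrix φ) (WellScoped-toMatrix φ) v ρ) (Σ-⇔ λ i → SatM-toMatrix φ w _)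

-- With y set to x, a formula whose only free variable is x keeps its meaning.
thToBet : ∀ {k} → FOTh k → FOBet k
thToBet φ = atDiagonalF (toMatrix φ)

thToBet-marked : ∀ {k} (φ : FOTh k) → OneFree φ → EquivBT (thToBet φ) φ
thToBet-marked φ one w ρ = ⇔.trans (SatBet-atDiagonalF w ρ (toMatrix φ))
  (⇔.trans (SatM-toMatrix φ w _)
    (mk⇔ (Sat-agree thfacI w φ _ ρ agree) (Sat-agree thfacI w φ ρ _ (λ v f → sym (agree v f)))))
  where
  agree : Agree thfacI w φ (update {w = w} ρ vy (ρ vx)) ρ
  agree vx _ = refl
  agree vy f = ⊥-elim (one f)

thToBet-sentence : ∀ {k} (φ : FOTh k) → Sentence φ → EquivBT (∃' vx (thToBet φ)) φ
thToBet-sentence φ closed w ρ = mk⇔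
  (λ (_ , s) → Sat-agree thfacI w φ _ ρ (λ v f → ⊥-elim (closed v f)) (to (thToBet-marked φ (closed vy) w _) s))
  (λ s → ρ vx , from (thToBet-marked φ (closed vy) w _) (Sat-agree thfacI w φ ρ _ (λ v f → ⊥-elim (closed v f)) s))

betToTh : ∀ {k} → FOBet k → FOTh k
betToTh (letter a v) = letter a v
betToTh (u ≐ u') = u ≐ u'
betToTh (u ≺ u') = u ≺ u'
betToTh (bin p u u') = bin (p , 1) u u'
betToTh (¬' φ) = ¬' betToTh φ
betToTh (φ ∧' ψ) = betToTh φ ∧' betToTh ψ
betToTh (∃' v φ) = ∃' v (betToTh φ)

Free-betToTh : ∀ {k} v (φ : FOBet k) → Free v (betToTh φ) → Free v φ
Free-betToTh v (letter a u) f = f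
Free-betToTh v (u ≐ u') f = f
Free-betToTh v (u ≺ u') f = f
Free-betToTh v (bin p u u') f = f
Free-betToTh v (¬' φ) f = Free-betToTh v φ f
Free-betToTh v (φ ∧' ψ) (inj₁ f) = inj₁ (Free-betToTh v φ f)
Free-betToTh v (φ ∧' ψ) (inj₂ f) = inj₂ (Free-betToTh v ψ f)
Free-betToTh v (∃' u φ) f with v ≟v u
... | yes _ = f
... | no _ = Free-betToTh v φ f

∈⇒1≤length : ∀ {A : Set} {x : A} {xs : List A} → x ∈ xs → 1 ≤ length xs
∈⇒1≤length {xs = _ ∷ _} _ = s≤s z≤n

1≤length⇒∈ : ∀ {A : Set} (xs : List A) → 1 ≤ length xs → Σ A (_∈ xs)
1≤length⇒∈ (x ∷ xs) _ = x , here refl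

betfac⇔thfac₁ : ∀ {k} (u : List⁺ (Fin k)) (w : Word k) x (y : Fin (length w)) →
  betfacI w u x (toℕ y) ⇔ thfacI w (u , 1) x (toℕ y)
betfac⇔thfac₁ u w x y = mk⇔
  (λ (z , occ@(_ , z+|u|≤y , _)) → ∈⇒1≤length (∈-filter⁺ between? (∈-upTo⁺ (z<|w| z z+|u|≤y)) occ))
  (λ c → let (z , z∈) = 1≤length⇒∈ (filter between? (upTo (length w))) c
         in z , proj₂ (∈-filter⁻ between? {xs = upTo (length w)} z∈))
  where
  between? = occBetween? u w x (toℕ y)
  z<|w| : ∀ z → z + len⁺ u ≤ toℕ y → z < length w
  z<|w| z z+|u|≤y = <-trans (<-≤-trans (m<m+n z (1≤len⁺ u)) z+|u|≤y) (toℕ<n y)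

betToTh-equiv : ∀ {k} (φ : FOBet k) → EquivBT φ (betToTh φ)
betToTh-equiv (letter a v) w ρ = ⇔.refl
betToTh-equiv (u ≐ u') w ρ = ⇔.refl
betToTh-equiv (u ≺ u') w ρ = ⇔.refl
betToTh-equiv (bin p u u') w ρ = betfac⇔thfac₁ p w (toℕ (ρ u)) (ρ u')
betToTh-equiv (¬' φ) w ρ = ¬-cong-⇔ (betToTh-equiv φ w ρ)
betToTh-equiv (φ ∧' ψ) w ρ = betToTh-equiv φ w ρ ×-⇔ betToTh-equiv ψ w ρ
betToTh-equiv (∃' v φ) w ρ = Σ-⇔ λ i → betToTh-equiv φ w _

theorem2p7 : (k : ℕ) → SameLanguages k × SameMarked k
theorem2p7 k =
  ( (λ φ closed → betToTh φ , (λ v f → closed v (Free-betToTh v φ f)) , betToTh-equiv φ)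
  , (λ ψ closed → ∃' vx (thToBet ψ) , (λ { vx () ; vy () }) , thToBet-sentence ψ closed) )
  , ( (λ φ one → betToTh φ , (λ f → one (Free-betToTh vy φ f)) , betToTh-equiv φ)
    , (λ ψ one → thToBet ψ , (λ ()) , thToBet-marked ψ one) )
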